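{- The functor $G$ from the category $S4.2_{\Box\Diamond}$ to $\mathit{Rel}$ is faithful.
   Context: A modality is a finite (possibly empty) word over $\{\Box, \Diamond\}$. For a modality $A$ and $M \in \{\Box, \Diamond\}$, $MA$ denotes the word obtained by prefixing $M$. The category $S4.2_{\Box\Diamond}$ has the modalities as objects. Its primitive arrow terms are, for every modality $A$: - $\mathbf{1}_A : A \vdash A$; - $\varepsilon^\Box_A : \Box A \vdash A$ and $\varepsilon^\Diamond_A : A \vdash \Diamond A$; - $\delta^{\Box\Box}_A : \Box A \vdash \Box\Box A$ and $\delta^{\Diamond\Diamond}_A : \Diamond\Diamond A \vdash \Diamond A$; - $\chi^{\Diamond\Box}_A : \Diamond\Box A \vdash \Box\Diamond A$. Arrow terms are closed under composition (if $f : A \vdash B$ and $g : B \vdash C$ then $g \circ f : A \vdash C$) and, for $M \in \{\Box, \Diamond\}$, under $f : A \vdash B \mapsto Mf : MA \vdash MB$. Arrows are equivalence classes of arrow terms under the smallest equivalence relation that relates only terms of the same type, is a congruence for these operations, and contains all instances of the following equations (for all $A, B$, all $f : A \vdash B$ and composable $g, h$, with $M \in \{\Box, \Diamond\}$). Categorial and functorial equations: - $f \circ \mathbf{1}_A = \mathbf{1}_B \circ f = f$; - $h \circ (g \circ f) = (h \circ g) \circ f$; - $M\mathbf{1}_A = \mathbf{1}_{MA}$; - $M(g \circ f) = Mg \circ Mf$. Naturality equations: - $\varepsilon^\Box_B \circ \Box f = f \circ \varepsilon^\Box_A$; - $\Box\Box f \circ \delta^{\Box\Box}_A = \delta^{\Box\Box}_B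 \circ \Box f$; - $\Diamond f \circ \varepsilon^\Diamond_A = \varepsilon^\Diamond_B \circ f$; - $\delta^{\Diamond\Diamond}_B \circ \Diamond\Diamond f = \Diamond f \circ \delta^{\Diamond\Diamond}_A$. Comonad equations: - $\Box\delta^{\Box\Box}_A \circ \delta^{\Box\Box}_A = \delta^{\Box\Box}_{\Box A} \circ \delta^{\Box\Box}_A$; - $\varepsilon^\Box_{\Box A} \circ \delta^{\Box\Box}_A = \mathbf{1}_{\Box A}$; - $\Box\varepsilon^\Box_A \circ \delta^{\Box\Box}_A = \mathbf{1}_{\Box A}$. Monad equations: - $\delta^{\Diamond\Diamond}_A \circ \Diamond\delta^{\Diamond\Diamond}_A = \delta^{\Diamond\Diamond}_A \circ \delta^{\Diamond\Diamond}_{\Diamond A}$; - $\delta^{\Diamond\Diamond}_A \circ \varepsilon^\Diamond_{\Diamond A} = \mathbf{1}_{\Diamond A}$; - $\delta^{\Diamond\Diamond}_A \circ \Diamond\varepsilon^\Diamond_A = \mathbf{1}_{\Diamond A}$. Equations for $\chi^{\Diamond\Box}$: - $\Box\Diamond f \circ \chi^{\Diamond\Box}_A = \chi^{\Diamond\Box}_B \circ \Diamond\Box f$; - $\varepsilon^\Box_{\Diamond A} \circ \chi^{\Diamond\Box}_A = \Diamond\varepsilon^\Box_A$; - $\chi^{\Diamond\Box}_A \circ \varepsilon^\Diamond_{\Box A} = \Box\varepsilon^\Diamond_A$; - $\delta^{\Box\Box}_{\Diamond A} \circ \chi^{\Diamond\Box}_A = \Box\chi^{\Diamond\Box}_A \circ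 \chi^{\Diamond\Box}_{\Box A} \circ \Diamond\delta^{\Box\Box}_A$; - $\chi^{\Diamond\Box}_A \circ \delta^{\Diamond\Diamond}_{\Box A} = \Box\delta^{\Diamond\Diamond}_A \circ \chi^{\Diamond\Box}_{\Diamond A} \circ \Diamond\chi^{\Diamond\Box}_A$. $\mathit{Rel}$ is the category whose objects are the finite ordinals and whose arrows $n \to m$ are relations $R \subseteq n \times m$, with relational composition. The functor $G$ sends a modality to its length. Occurrences in a modality of length $n$ are numbered $n-1, \dots, 0$ from left to right. For $A$ of length $n$: - $G\mathbf{1}_A$ is the identity; - $G\varepsilon^\Box_A = \{(i,i) : i < n\}$, and $G\varepsilon^\Diamond_A = \{(i,i) : i < n\}$; - $G\delta^{\Box\Box}_A = \{(i,i) : i < n\} \cup \{(n,n), (n,n+1)\}$; - $G\delta^{\Diamond\Diamond}_A = \{(i,i) : i < n\} \cup \{(n,n), (n+1,n)\}$; - $G\chi^{\Diamond\Box}_A = \{(i,i) : i < n\} \cup \{(n,n+1), (n+1,n)\}$; - $G(g \circ f) = Gg \circ Gf$; - for $f : A \vdash B$ with lengths $n$ and $m$, $GMf = Gf \cup \{(n,m)\}$. -}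

module Defs where

open import Data.List using (List; []; _∷_; length)
open import Data.Nat using (ℕ; suc; _<_)
open import Data.Product using (Σ; _×_)
open import Data.Sum using (_⊎_)
open import Relation.Binary.PropositionalEquality using (_≡_)
open import Function.Bundles using (_⇔_)

data Sym : Set where
  □ ◇ : Sym

-- A modality is a finite word over {□, ◇}; M ∷ A is the prefixing MA.
Modality : Set
Modality = List Sym

infixr 9 _∘_
data Term : Modality → Modality → Set where
  𝟏   : (A : Modality) → Term A A
  ε□  : (A : Modality) → Term (□ ∷ A) A
  ε◇  : (A : Modality) → Term A (◇ ∷ A)
  δ□□ : (A : Modality) → Term (□ ∷ A) (□ ∷ □ ∷ A)
  δ◇◇ : (A : Modality) → Term (◇ ∷ ◇ ∷ A) (◇ ∷ A)
  χ◇□ : (A : Modality) → Term (◇ ∷ □ ∷ A) (□ ∷ ◇ ∷ A)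
  _∘_ : {A B C : Modality} → Term B C → Term A B → Term A C
  ⟪_⟫_ : {A B : Modality} (M : Sym) → Term A B → Term (M ∷ A) (M ∷ B)

infix 4 _≈_
data _≈_ : {A B : Modality} → Term A B → Term A B → Set where
  ≈-refl  : ∀ {A B} {f : Term A B} → f ≈ f
  ≈-sym   : ∀ {A B} {f g : Term A B} → f ≈ g → g ≈ f
  ≈-trans : ∀ {A B} {f g h : Term A B} → f ≈ g → g ≈ h → f ≈ h
  ∘-cong  : ∀ {A B C} {f f' : Term A B} {g g' : Term B C} →
            f ≈ f' → g ≈ g' → g ∘ f ≈ g' ∘ f'
  ⟪⟫-cong : ∀ {A B} (M : Sym) {f f' : Term A B} → f ≈ f' → ⟪ M ⟫ f ≈ ⟪ M ⟫ f'
  idʳ     : ∀ {A B} (f : Term A B) → f ∘ 𝟏 A ≈ f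
  idˡ     : ∀ {A B} (f : Term A B) → 𝟏 B ∘ f ≈ f
  assoc   : ∀ {A B C D} (f : Term A B) (g : Term B C) (h : Term C D) →
            h ∘ (g ∘ f) ≈ (h ∘ g) ∘ f
  fun-id  : ∀ (M : Sym) (A : Modality) → ⟪ M ⟫ (𝟏 A) ≈ 𝟏 (M ∷ A)
  fun-∘   : ∀ (M : Sym) {A B C} (f : Term A B) (g : Term B C) →
            ⟪ M ⟫ (g ∘ f) ≈ ⟪ M ⟫ g ∘ ⟪ M ⟫ f
  nat-ε□  : ∀ {A B} (f : Term A B) → ε□ B ∘ ⟪ □ ⟫ f ≈ f ∘ ε□ A
  nat-δ□□ : ∀ {A B} (f : Term A B) → ⟪ □ ⟫ (⟪ □ ⟫ f) ∘ δ□□ A ≈ δ□□ B ∘ ⟪ □ ⟫ f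
  nat-ε◇  : ∀ {A B} (f : Term A B) → ⟪ ◇ ⟫ f ∘ ε◇ A ≈ ε◇ B ∘ f
  nat-δ◇◇ : ∀ {A B} (f : Term A B) → δ◇◇ B ∘ ⟪ ◇ ⟫ (⟪ ◇ ⟫ f) ≈ ⟪ ◇ ⟫ f ∘ δ◇◇ A
  com-δ   : ∀ A → ⟪ □ ⟫ (δ□□ A) ∘ δ□□ A ≈ δ□□ (□ ∷ A) ∘ δ□□ A
  com-εδ  : ∀ A → ε□ (□ ∷ A) ∘ δ□□ A ≈ 𝟏 (□ ∷ A)
  com-□εδ : ∀ A → ⟪ □ ⟫ (ε□ A) ∘ δ□□ A ≈ 𝟏 (□ ∷ A)
  mon-δ   : ∀ A → δ◇◇ A ∘ ⟪ ◇ ⟫ (δ◇◇ A) ≈ δ◇◇ A ∘ δ◇◇ (◇ ∷ A)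
  mon-δε  : ∀ A → δ◇◇ A ∘ ε◇ (◇ ∷ A) ≈ 𝟏 (◇ ∷ A)
  mon-δ◇ε : ∀ A → δ◇◇ A ∘ ⟪ ◇ ⟫ (ε◇ A) ≈ 𝟏 (◇ ∷ A)
  nat-χ   : ∀ {A B} (f : Term A B) →
            ⟪ □ ⟫ (⟪ ◇ ⟫ f) ∘ χ◇□ A ≈ χ◇□ B ∘ ⟪ ◇ ⟫ (⟪ □ ⟫ f)
  χ-ε□    : ∀ A → ε□ (◇ ∷ A) ∘ χ◇□ A ≈ ⟪ ◇ ⟫ (ε□ A)
  χ-ε◇    : ∀ A → χ◇□ A ∘ ε◇ (□ ∷ A) ≈ ⟪ □ ⟫ (ε◇ A)
  χ-δ□□   : ∀ A → δ□□ (◇ ∷ A) ∘ χ◇□ A ≈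
            (⟪ □ ⟫ (χ◇□ A) ∘ χ◇□ (□ ∷ A)) ∘ ⟪ ◇ ⟫ (δ□□ A)
  χ-δ◇◇   : ∀ A → χ◇□ A ∘ δ◇◇ (□ ∷ A) ≈
            (⟪ □ ⟫ (δ◇◇ A) ∘ χ◇□ (◇ ∷ A)) ∘ ⟪ ◇ ⟫ (χ◇□ A)

-- Relations between finite ordinals, represented as predicates on ℕ × ℕ
-- (G only ever relates i < length A to j < length B).
Rel₀ : Set₁
Rel₀ = ℕ → ℕ → Set

Δ : ℕ → Rel₀
Δ n i j = (i ≡ j) × (i < n)

-- The functor G on arrow terms (occurrences numbered n-1,…,0 left to right).
G : {A B : Modality} → Term A B → Rel₀
G (𝟏 A)   = Δ (length A)
G (ε□ A)  = Δ (length A)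
G (ε◇ A)  = Δ (length A)
G (δ□□ A) i j = Δ (length A) i j ⊎ ((i ≡ length A × j ≡ length A) ⊎ (i ≡ length A × j ≡ suc (length A)))
G (δ◇◇ A) i j = Δ (length A) i j ⊎ ((i ≡ length A × j ≡ length A) ⊎ (i ≡ suc (length A) × j ≡ length A))
G (χ◇□ A) i j = Δ (length A) i j ⊎ ((i ≡ length A × j ≡ suc (length A)) ⊎ (i ≡ suc (length A) × j ≡ length A))
G (_∘_ {B = B} g f) i k = Σ ℕ (λ j → G f i j × G g j k)
G (⟪_⟫_ {A = A} {B = B} M f) i j = G f i j ⊎ (i ≡ length A × j ≡ length B)

_≐_ : Rel₀ → Rel₀ → Set
R ≐ S = ∀ i j → R i j ⇔ S i j

-- Every arrow is equal to a normal form: a normal form is an explicit description of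
-- how the letters of the source are kept, dropped, duplicated or merged into the letters
-- of the target, and letting the primitive arrows act on the identity normal form by
-- postcomposition turns any term into an equal normal form, each step of the action
-- being justified by the equations.  Since G respects the equations, it suffices to show
-- that G separates normal forms.  On a normal form G is computed letter by letter, and
-- the links of the first letter of the source and of the target determine which
-- constructor comes first; it can be peeled off both normal forms alike, and induction
-- finishes the argument.

module Submission where

open import Data.List using ([]; _∷_; length)
open import Data.Nat using (ℕ; zero; suc; _<_; _≤_; s≤s)
open import Data.Nat.Properties
  using (n<1+n; m<n⇒m<1+n; m<1+n⇒m<n∨m≡n; n≮n; 1+n≢n; <-trans; ≤-refl; ≤-trans; <⇒≤; m≤n⇒m≤1+n;
         <-≤-trans; <-cmp; <⇒≱; ≤-reflexive; suc-injective)
open import Data.Product using (Σ; _×_; _,_; proj₁; proj₂) renaming (map to ×-map)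
open import Data.Sum using (_⊎_; inj₁; inj₂; [_,_]′; swap) renaming (map to ⊎-map)
open import Data.Empty using (⊥; ⊥-elim)
open import Relation.Binary.PropositionalEquality using (_≡_; refl; sym; trans; cong; subst)
open import Relation.Binary.Core using (_⇒_)
open import Relation.Binary.Definitions using (tri<; tri≈; tri>)
open import Relation.Nullary using (¬_)
open import Function.Bundles using (Equivalence; mk⇔)
open import Defs

open Equivalence using (to; from)

infix 3 _∎
infixr 2 _≈⟨_⟩_ _⨾_
infix 1 begin_
infixl 5 _⟩∘_
infixr 5 _∘⟨_

begin_ : ∀ {A B} {f g : Term A B} → f ≈ g → f ≈ g
begin p = p

_≈⟨_⟩_ : ∀ {A B} (f : Term A B) {g h : Term A B} → f ≈ g → g ≈ h → f ≈ h
f ≈⟨ p ⟩ q = ≈-trans p q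

_∎ : ∀ {A B} (f : Term A B) → f ≈ f
f ∎ = ≈-refl

_⨾_ : ∀ {A B} {f g h : Term A B} → f ≈ g → g ≈ h → f ≈ h
_⨾_ = ≈-trans

_⟩∘_ : ∀ {A B C} {g g' : Term B C} → g ≈ g' → (f : Term A B) → g ∘ f ≈ g' ∘ f
p ⟩∘ f = ∘-cong ≈-refl p

_∘⟨_ : ∀ {A B C} (g : Term B C) {f f' : Term A B} → f ≈ f' → g ∘ f ≈ g ∘ f'
g ∘⟨ p = ∘-cong p ≈-refl

assocˡ : ∀ {A B C D} {h : Term C D} {g : Term B C} {f : Term A B} → h ∘ (g ∘ f) ≈ (h ∘ g) ∘ f
assocˡ = assoc _ _ _

assocʳ : ∀ {A B C D} {h : Term C D} {g : Term B C} {f : Term A B} → (h ∘ g) ∘ f ≈ h ∘ (g ∘ f)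
assocʳ = ≈-sym assocˡ

∘-extendʳ : ∀ {A B C D} {x : Term B D} {s : Term C D} {n : Term B C} (c : Term A B) →
            x ≈ s ∘ n → x ∘ c ≈ s ∘ (n ∘ c)
∘-extendʳ c p = (p ⟩∘ c) ⨾ assocʳ

⟪⟫-∘ : ∀ M {A B C} {g : Term B C} {f : Term A B} → ⟪ M ⟫ (g ∘ f) ≈ ⟪ M ⟫ g ∘ ⟪ M ⟫ f
⟪⟫-∘ M = fun-∘ M _ _

◇^ : ℕ → Modality → Modality
◇^ zero A = A
◇^ (suc k) A = ◇ ∷ ◇^ k A

◇^-map : ∀ k {A B} → Term A B → Term (◇^ k A) (◇^ k B)
◇^-map zero f = f
◇^-map (suc k) f = ⟪ ◇ ⟫ (◇^-map k f)

-- The two sides are the same word, but not definitionally for a variable k.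
◇^-cast : ∀ k A → Term (◇^ k (◇ ∷ A)) (◇ ∷ ◇^ k A)
◇^-cast zero A = 𝟏 (◇ ∷ A)
◇^-cast (suc k) A = ⟪ ◇ ⟫ (◇^-cast k A)

χ^ : ∀ k A → Term (◇^ k (□ ∷ A)) (□ ∷ ◇^ k A)
χ^ zero A = 𝟏 (□ ∷ A)
χ^ (suc k) A = χ◇□ (◇^ k A) ∘ ⟪ ◇ ⟫ (χ^ k A)

χ^δ : ∀ k A → Term (◇^ k (□ ∷ A)) (□ ∷ ◇^ k (□ ∷ A))
χ^δ k A = χ^ k (□ ∷ A) ∘ ◇^-map k (δ□□ A)

χ^δ-suc : ∀ k A → χ^δ (suc k) A ≈ χ◇□ (◇^ k (□ ∷ A)) ∘ ⟪ ◇ ⟫ (χ^δ k A)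
χ^δ-suc k A = assocʳ ⨾ (_ ∘⟨ ≈-sym (⟪⟫-∘ ◇))

◇^-map-∘ : ∀ k {A B C} {g : Term B C} {f : Term A B} → ◇^-map k (g ∘ f) ≈ ◇^-map k g ∘ ◇^-map k f
◇^-map-∘ zero = ≈-refl
◇^-map-∘ (suc k) = ⟪⟫-cong ◇ (◇^-map-∘ k) ⨾ ⟪⟫-∘ ◇

◇^-map-id : ∀ k A → ◇^-map k (𝟏 A) ≈ 𝟏 (◇^ k A)
◇^-map-id zero A = ≈-refl
◇^-map-id (suc k) A = ⟪⟫-cong ◇ (◇^-map-id k A) ⨾ fun-id ◇ _

◇^-map-cong : ∀ k {A B} {f f' : Term A B} → f ≈ f' → ◇^-map k f ≈ ◇^-map k f'
◇^-map-cong zero p = p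
◇^-map-cong (suc k) p = ⟪⟫-cong ◇ (◇^-map-cong k p)

ε□-χ^ : ∀ k A → ε□ (◇^ k A) ∘ χ^ k A ≈ ◇^-map k (ε□ A)
ε□-χ^ zero A = idʳ _
ε□-χ^ (suc k) A = begin
  ε□ (◇ ∷ ◇^ k A) ∘ (χ◇□ (◇^ k A) ∘ ⟪ ◇ ⟫ (χ^ k A))  ≈⟨ assocˡ ⟩
  (ε□ (◇ ∷ ◇^ k A) ∘ χ◇□ (◇^ k A)) ∘ ⟪ ◇ ⟫ (χ^ k A)  ≈⟨ χ-ε□ _ ⟩∘ _ ⟩
  ⟪ ◇ ⟫ (ε□ (◇^ k A)) ∘ ⟪ ◇ ⟫ (χ^ k A)              ≈⟨ ≈-sym (⟪⟫-∘ ◇) ⟩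
  ⟪ ◇ ⟫ (ε□ (◇^ k A) ∘ χ^ k A)                      ≈⟨ ⟪⟫-cong ◇ (ε□-χ^ k A) ⟩
  ⟪ ◇ ⟫ (◇^-map k (ε□ A))                           ∎

χ^-natural : ∀ k {X Y} (f : Term X Y) → ⟪ □ ⟫ (◇^-map k f) ∘ χ^ k X ≈ χ^ k Y ∘ ◇^-map k (⟪ □ ⟫ f)
χ^-natural zero f = idʳ _ ⨾ ≈-sym (idˡ _)
χ^-natural (suc k) {X} {Y} f = begin
  ⟪ □ ⟫ (⟪ ◇ ⟫ (◇^-map k f)) ∘ (χ◇□ (◇^ k X) ∘ ⟪ ◇ ⟫ (χ^ k X))  ≈⟨ assocˡ ⟩
  (⟪ □ ⟫ (⟪ ◇ ⟫ (◇^-map k f)) ∘ χ◇□ (◇^ k X)) ∘ ⟪ ◇ ⟫ (χ^ k X)  ≈⟨ nat-χ _ ⟩∘ _ ⟩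
  (χ◇□ (◇^ k Y) ∘ ⟪ ◇ ⟫ (⟪ □ ⟫ (◇^-map k f))) ∘ ⟪ ◇ ⟫ (χ^ k X)  ≈⟨ assocʳ ⟩
  χ◇□ (◇^ k Y) ∘ (⟪ ◇ ⟫ (⟪ □ ⟫ (◇^-map k f)) ∘ ⟪ ◇ ⟫ (χ^ k X))  ≈⟨ _ ∘⟨ ≈-sym (⟪⟫-∘ ◇) ⟩
  χ◇□ (◇^ k Y) ∘ ⟪ ◇ ⟫ (⟪ □ ⟫ (◇^-map k f) ∘ χ^ k X)            ≈⟨ _ ∘⟨ ⟪⟫-cong ◇ (χ^-natural k f) ⟩
  χ◇□ (◇^ k Y) ∘ ⟪ ◇ ⟫ (χ^ k Y ∘ ◇^-map k (⟪ □ ⟫ f))            ≈⟨ _ ∘⟨ ⟪⟫-∘ ◇ ⟩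
  χ◇□ (◇^ k Y) ∘ (⟪ ◇ ⟫ (χ^ k Y) ∘ ⟪ ◇ ⟫ (◇^-map k (⟪ □ ⟫ f)))  ≈⟨ assocˡ ⟩
  (χ◇□ (◇^ k Y) ∘ ⟪ ◇ ⟫ (χ^ k Y)) ∘ ⟪ ◇ ⟫ (◇^-map k (⟪ □ ⟫ f))  ∎

δ□□-χ^ : ∀ k A → δ□□ (◇^ k A) ∘ χ^ k A ≈ ⟪ □ ⟫ (χ^ k A) ∘ χ^δ k A
δ□□-χ^ zero A = idʳ _ ⨾ ≈-sym (idˡ _ ⨾ idˡ _) ⨾ (≈-sym (fun-id □ _) ⟩∘ _)
δ□□-χ^ (suc k) A = begin
  δ□□ (◇ ∷ X) ∘ (χ◇□ X ∘ ⟪ ◇ ⟫ (χ^ k A))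
    ≈⟨ assocˡ ⟩
  (δ□□ (◇ ∷ X) ∘ χ◇□ X) ∘ ⟪ ◇ ⟫ (χ^ k A)
    ≈⟨ χ-δ□□ _ ⟩∘ _ ⟩
  ((⟪ □ ⟫ (χ◇□ X) ∘ χ◇□ (□ ∷ X)) ∘ ⟪ ◇ ⟫ (δ□□ X)) ∘ ⟪ ◇ ⟫ (χ^ k A)
    ≈⟨ assocʳ ⨾ (_ ∘⟨ ≈-sym (⟪⟫-∘ ◇)) ⟩
  (⟪ □ ⟫ (χ◇□ X) ∘ χ◇□ (□ ∷ X)) ∘ ⟪ ◇ ⟫ (δ□□ X ∘ χ^ k A)
    ≈⟨ _ ∘⟨ ⟪⟫-cong ◇ (δ□□-χ^ k A) ⟩
  (⟪ □ ⟫ (χ◇□ X) ∘ χ◇□ (□ ∷ X)) ∘ ⟪ ◇ ⟫ (⟪ □ ⟫ (χ^ k A) ∘ χ^δ k A)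
    ≈⟨ _ ∘⟨ ⟪⟫-∘ ◇ ⟩
  (⟪ □ ⟫ (χ◇□ X) ∘ χ◇□ (□ ∷ X)) ∘ (⟪ ◇ ⟫ (⟪ □ ⟫ (χ^ k A)) ∘ ⟪ ◇ ⟫ (χ^δ k A))
    ≈⟨ assocʳ ⨾ (_ ∘⟨ assocˡ) ⟩
  ⟪ □ ⟫ (χ◇□ X) ∘ ((χ◇□ (□ ∷ X) ∘ ⟪ ◇ ⟫ (⟪ □ ⟫ (χ^ k A))) ∘ ⟪ ◇ ⟫ (χ^δ k A))
    ≈⟨ _ ∘⟨ (≈-sym (nat-χ _) ⟩∘ _) ⟩
  ⟪ □ ⟫ (χ◇□ X) ∘ ((⟪ □ ⟫ (⟪ ◇ ⟫ (χ^ k A)) ∘ χ◇□ (◇^ k (□ ∷ A))) ∘ ⟪ ◇ ⟫ (χ^δ k A))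
    ≈⟨ (_ ∘⟨ assocʳ) ⨾ assocˡ ⟩
  (⟪ □ ⟫ (χ◇□ X) ∘ ⟪ □ ⟫ (⟪ ◇ ⟫ (χ^ k A))) ∘ (χ◇□ (◇^ k (□ ∷ A)) ∘ ⟪ ◇ ⟫ (χ^δ k A))
    ≈⟨ ∘-cong (≈-sym (χ^δ-suc k A)) (≈-sym (⟪⟫-∘ □)) ⟩
  ⟪ □ ⟫ (χ^ (suc k) A) ∘ χ^δ (suc k) A ∎
  where X = ◇^ k A

□ε□-χ^δ : ∀ k A → ⟪ □ ⟫ (◇^-map k (ε□ A)) ∘ χ^δ k A ≈ χ^ k A
□ε□-χ^δ k A = assocˡ ⨾ (χ^-natural k (ε□ A) ⟩∘ _) ⨾ assocʳ
  ⨾ (_ ∘⟨ (≈-sym (◇^-map-∘ k) ⨾ ◇^-map-cong k (com-□εδ A) ⨾ ◇^-map-id k _)) ⨾ idʳ _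

-- NF k A B: normal forms of arrows ◇^ k A ⊢ B.  The source is read from the left; the
-- k diamonds already read and not yet attached to a diamond of the target are pending.
data NF : ℕ → Modality → Modality → Set where
  nil    : NF 0 [] []
  new◇   : ∀ {k A B} → NF k A B → NF k A (◇ ∷ B)
  keep◇  : ∀ {k A B} → NF k A B → NF (suc k) A (◇ ∷ B)
  merge◇ : ∀ {k A B} → NF k A (◇ ∷ B) → NF (suc k) A (◇ ∷ B)
  pend◇  : ∀ {k A B} → NF (suc k) A B → NF k (◇ ∷ A) B
  drop□  : ∀ {k A B} → NF k A B → NF k (□ ∷ A) B
  keep□  : ∀ {k A B} → NF k A B → NF k (□ ∷ A) (□ ∷ B)
  dup□   : ∀ {k A B} → NF k (□ ∷ A) B → NF k (□ ∷ A) (□ ∷ B)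

reify : ∀ {k A B} → NF k A B → Term (◇^ k A) B
reify nil = 𝟏 []
reify (new◇ {B = B} n) = ε◇ B ∘ reify n
reify (keep◇ n) = ⟪ ◇ ⟫ reify n
reify (merge◇ {B = B} n) = δ◇◇ B ∘ ⟪ ◇ ⟫ reify n
reify (pend◇ {k} {A} n) = reify n ∘ ◇^-cast k A
reify (drop□ {k} {A} n) = reify n ∘ ◇^-map k (ε□ A)
reify (keep□ {k} {A} n) = ⟪ □ ⟫ reify n ∘ χ^ k A
reify (dup□ {k} {A} n) = ⟪ □ ⟫ reify n ∘ χ^δ k A

-- Normalisation: generators act on normal forms by postcomposition

data Gen : Modality → Modality → Set where
  gε□ : ∀ A → Gen (□ ∷ A) A
  gδ□ : ∀ A → Gen (□ ∷ A) (□ ∷ □ ∷ A)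
  gε◇ : ∀ A → Gen A (◇ ∷ A)
  gδ◇ : ∀ A → Gen (◇ ∷ ◇ ∷ A) (◇ ∷ A)
  gχ  : ∀ A → Gen (◇ ∷ □ ∷ A) (□ ∷ ◇ ∷ A)

-- The monad generators get an action of their own: the action of χ applies it to a
-- normal form that is not a structural subterm of its argument, which would defeat the
-- termination checker if both actions were one function.
data ◇Gen : Modality → Modality → Set where
  dε : ∀ A → ◇Gen A (◇ ∷ A)
  dδ : ∀ A → ◇Gen (◇ ∷ ◇ ∷ A) (◇ ∷ A)

genTerm : ∀ {A B} → Gen A B → Term A B
genTerm (gε□ A) = ε□ A
genTerm (gδ□ A) = δ□□ A
genTerm (gε◇ A) = ε◇ A
genTerm (gδ◇ A) = δ◇◇ A
genTerm (gχ A) = χ◇□ A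

◇genTerm : ∀ {A B} → ◇Gen A B → Term A B
◇genTerm (dε A) = ε◇ A
◇genTerm (dδ A) = δ◇◇ A

data Step (X : Modality → Modality → Set) : Modality → Modality → Set where
  here  : ∀ {A B} → X A B → Step X A B
  under : ∀ {A B} (M : Sym) → Step X A B → Step X (M ∷ A) (M ∷ B)

stepTerm : ∀ {X} → (∀ {A B} → X A B → Term A B) → ∀ {A B} → Step X A B → Term A B
stepTerm t (here g) = t g
stepTerm t (under M s) = ⟪ M ⟫ (stepTerm t s)

NFAction : (Modality → Modality → Set) → Set
NFAction X = ∀ {k A B B'} → X B B' → NF k A B → NF k A B'

Realises : ∀ {X} → (∀ {A B} → X A B → Term A B) → NFAction X → Set
Realises {X} t act = ∀ {k A B B'} (x : X B B') (n : NF k A B) → reify (act x n) ≈ t x ∘ reify n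

actStep : ∀ {X} → NFAction X → NFAction (Step X)
actStep act (here x) n = act x n
actStep act (under M s) (new◇ n) = new◇ (actStep act s n)
actStep act (under M s) (keep◇ n) = keep◇ (actStep act s n)
actStep act (under M s) (merge◇ n) = merge◇ (actStep act (under ◇ s) n)
actStep act (under M s) (pend◇ n) = pend◇ (actStep act (under M s) n)
actStep act (under M s) (drop□ n) = drop□ (actStep act (under M s) n)
actStep act (under M s) (keep□ n) = keep□ (actStep act s n)
actStep act (under M s) (dup□ n) = dup□ (actStep act s n)

actStep-sound : ∀ {X} {t : ∀ {A B} → X A B → Term A B} {act : NFAction X} →
                Realises t act → Realises (stepTerm t) (actStep act)
actStep-sound act-sound (here x) n = act-sound x n
actStep-sound act-sound (under M s) (new◇ n) =
  (_ ∘⟨ actStep-sound act-sound s n) ⨾ assocˡ ⨾ (≈-sym (nat-ε◇ _) ⟩∘ _) ⨾ assocʳ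
actStep-sound act-sound (under M s) (keep◇ n) = ⟪⟫-cong ◇ (actStep-sound act-sound s n) ⨾ ⟪⟫-∘ ◇
actStep-sound act-sound (under M s) (merge◇ n) =
  (_ ∘⟨ (⟪⟫-cong ◇ (actStep-sound act-sound (under ◇ s) n) ⨾ ⟪⟫-∘ ◇)) ⨾ assocˡ
  ⨾ (nat-δ◇◇ _ ⟩∘ _) ⨾ assocʳ
actStep-sound act-sound (under M s) (pend◇ n) = ∘-extendʳ _ (actStep-sound act-sound (under M s) n)
actStep-sound act-sound (under M s) (drop□ n) = ∘-extendʳ _ (actStep-sound act-sound (under M s) n)
actStep-sound act-sound (under M s) (keep□ n) =
  ((⟪⟫-cong □ (actStep-sound act-sound s n) ⨾ ⟪⟫-∘ □) ⟩∘ _) ⨾ assocʳ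
actStep-sound act-sound (under M s) (dup□ n) =
  ((⟪⟫-cong □ (actStep-sound act-sound s n) ⨾ ⟪⟫-∘ □) ⟩∘ _) ⨾ assocʳ

act◇Gen : NFAction ◇Gen
act◇Gen (dε A) n = new◇ n
act◇Gen (dδ A) (new◇ n) = n
act◇Gen (dδ A) (keep◇ n) = merge◇ n
act◇Gen (dδ A) (merge◇ n) = merge◇ (act◇Gen (dδ A) n)
act◇Gen (dδ A) (pend◇ n) = pend◇ (act◇Gen (dδ A) n)
act◇Gen (dδ A) (drop□ n) = drop□ (act◇Gen (dδ A) n)

act◇Gen-sound : Realises ◇genTerm act◇Gen
act◇Gen-sound (dε A) n = ≈-refl
act◇Gen-sound (dδ A) (new◇ n) = ≈-sym (assocˡ ⨾ (mon-δε _ ⟩∘ _) ⨾ idˡ _)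
act◇Gen-sound (dδ A) (keep◇ n) = ≈-refl
act◇Gen-sound (dδ A) (merge◇ n) =
  (_ ∘⟨ (⟪⟫-cong ◇ (act◇Gen-sound (dδ A) n) ⨾ ⟪⟫-∘ ◇)) ⨾ assocˡ ⨾ (mon-δ _ ⟩∘ _) ⨾ assocʳ
act◇Gen-sound (dδ A) (pend◇ n) = ∘-extendʳ _ (act◇Gen-sound (dδ A) n)
act◇Gen-sound (dδ A) (drop□ n) = ∘-extendʳ _ (act◇Gen-sound (dδ A) n)

actχ : ∀ {k A B} → NF k A (□ ∷ B) → NF (suc k) A (□ ∷ ◇ ∷ B)
actχ (pend◇ n) = pend◇ (actχ n)
actχ (drop□ n) = drop□ (actχ n)
actχ (keep□ n) = keep□ (keep◇ n)
actχ (dup□ n) = dup□ (keep◇ n)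

actχ-sound : ∀ {k A B} (n : NF k A (□ ∷ B)) → reify (actχ n) ≈ χ◇□ B ∘ ⟪ ◇ ⟫ reify n
actχ-sound (pend◇ n) = ∘-extendʳ _ (actχ-sound n) ⨾ (_ ∘⟨ ≈-sym (⟪⟫-∘ ◇))
actχ-sound (drop□ n) = ∘-extendʳ _ (actχ-sound n) ⨾ (_ ∘⟨ ≈-sym (⟪⟫-∘ ◇))
actχ-sound (keep□ n) = assocˡ ⨾ (nat-χ _ ⟩∘ _) ⨾ assocʳ ⨾ (_ ∘⟨ ≈-sym (⟪⟫-∘ ◇))
actχ-sound (dup□ n) = (_ ∘⟨ assocʳ) ⨾ assocˡ ⨾ (nat-χ _ ⟩∘ _) ⨾ assocʳ
  ⨾ (_ ∘⟨ ≈-sym (⟪⟫-∘ ◇ ⨾ (_ ∘⟨ ⟪⟫-∘ ◇)))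

actGen : NFAction Gen
actGen (gε◇ A) n = new◇ n
actGen (gδ◇ A) n = act◇Gen (dδ A) n
actGen (gε□ A) (pend◇ n) = pend◇ (actGen (gε□ A) n)
actGen (gε□ A) (drop□ n) = drop□ (actGen (gε□ A) n)
actGen (gε□ A) (keep□ n) = drop□ n
actGen (gε□ A) (dup□ n) = n
actGen (gδ□ A) (pend◇ n) = pend◇ (actGen (gδ□ A) n)
actGen (gδ□ A) (drop□ n) = drop□ (actGen (gδ□ A) n)
actGen (gδ□ A) (keep□ n) = dup□ (keep□ n)
actGen (gδ□ A) (dup□ n) = dup□ (dup□ n)
actGen (gχ A) (new◇ n) = actStep act◇Gen (under □ (here (dε A))) n
actGen (gχ A) (keep◇ n) = actχ n
actGen (gχ A) (merge◇ n) = actStep act◇Gen (under □ (here (dδ A))) (actχ (actGen (gχ A) n))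
actGen (gχ A) (pend◇ n) = pend◇ (actGen (gχ A) n)
actGen (gχ A) (drop□ n) = drop□ (actGen (gχ A) n)

actGen-sound : Realises genTerm actGen
actGen-sound (gε◇ A) n = ≈-refl
actGen-sound (gδ◇ A) n = act◇Gen-sound (dδ A) n
actGen-sound (gε□ A) (pend◇ n) = ∘-extendʳ _ (actGen-sound (gε□ A) n)
actGen-sound (gε□ A) (drop□ n) = ∘-extendʳ _ (actGen-sound (gε□ A) n)
actGen-sound (gε□ A) (keep□ {k} {A'} n) =
  ≈-sym (assocˡ ⨾ (nat-ε□ _ ⟩∘ _) ⨾ assocʳ ⨾ (_ ∘⟨ ε□-χ^ k A'))
actGen-sound (gε□ A) (dup□ {k} {A'} n) =
  ≈-sym (assocˡ ⨾ (nat-ε□ _ ⟩∘ _) ⨾ assocʳ ⨾ (_ ∘⟨ ε□-χ^δ) ⨾ idʳ _)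
  where
  ε□-χ^δ : ε□ (◇^ k (□ ∷ A')) ∘ χ^δ k A' ≈ 𝟏 (◇^ k (□ ∷ A'))
  ε□-χ^δ = assocˡ ⨾ (ε□-χ^ k (□ ∷ A') ⟩∘ _) ⨾ ≈-sym (◇^-map-∘ k)
         ⨾ ◇^-map-cong k (com-εδ A') ⨾ ◇^-map-id k _
actGen-sound (gδ□ A) (pend◇ n) = ∘-extendʳ _ (actGen-sound (gδ□ A) n)
actGen-sound (gδ□ A) (drop□ n) = ∘-extendʳ _ (actGen-sound (gδ□ A) n)
actGen-sound (gδ□ A) (keep□ {k} {A'} n) =
  ≈-sym (assocˡ ⨾ (≈-sym (nat-δ□□ _) ⟩∘ _) ⨾ assocʳ ⨾ (_ ∘⟨ δ□□-χ^ k A') ⨾ assocˡ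
    ⨾ (≈-sym (⟪⟫-∘ □) ⟩∘ _))
actGen-sound (gδ□ A) (dup□ {k} {A'} n) =
  ((⟪⟫-∘ □ ⨾ (_ ∘⟨ ⟪⟫-∘ □)) ⟩∘ _) ⨾ assocʳ ⨾ (_ ∘⟨ (assocʳ ⨾ (_ ∘⟨ δ□□-χ^δ)))
  ⨾ ≈-sym (assocˡ ⨾ (≈-sym (nat-δ□□ _) ⟩∘ _) ⨾ assocʳ
    ⨾ (_ ∘⟨ (assocˡ ⨾ (δ□□-χ^ k (□ ∷ A') ⟩∘ _) ⨾ assocʳ)))
  where
  δ□□-χ^δ : ⟪ □ ⟫ (◇^-map k (δ□□ A')) ∘ χ^δ k A' ≈ χ^δ k (□ ∷ A') ∘ ◇^-map k (δ□□ A')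
  δ□□-χ^δ = assocˡ ⨾ (χ^-natural k (δ□□ A') ⟩∘ _) ⨾ assocʳ
          ⨾ (_ ∘⟨ (≈-sym (◇^-map-∘ k) ⨾ ◇^-map-cong k (com-δ A') ⨾ ◇^-map-∘ k)) ⨾ assocˡ
actGen-sound (gχ A) (new◇ n) =
  actStep-sound act◇Gen-sound (under □ (here (dε A))) n ⨾ ≈-sym (assocˡ ⨾ (χ-ε◇ _ ⟩∘ _))
actGen-sound (gχ A) (keep◇ n) = actχ-sound n
actGen-sound (gχ A) (merge◇ n) =
  actStep-sound act◇Gen-sound (under □ (here (dδ A))) _
  ⨾ (_ ∘⟨ (actχ-sound _ ⨾ (_ ∘⟨ (⟪⟫-cong ◇ (actGen-sound (gχ A) n) ⨾ ⟪⟫-∘ ◇))))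
  ⨾ ≈-sym (assocˡ ⨾ (χ-δ◇◇ _ ⟩∘ _) ⨾ assocʳ ⨾ assocʳ)
actGen-sound (gχ A) (pend◇ n) = ∘-extendʳ _ (actGen-sound (gχ A) n)
actGen-sound (gχ A) (drop□ n) = ∘-extendʳ _ (actGen-sound (gχ A) n)

data Context : Set where
  ε : Context
  _▸_ : Context → Sym → Context

plug : Context → Modality → Modality
plug ε B = B
plug (C ▸ M) B = plug C (M ∷ B)

plugTerm : ∀ C {A B} → Term A B → Term (plug C A) (plug C B)
plugTerm ε f = f
plugTerm (C ▸ M) f = plugTerm C (⟪ M ⟫ f)

plugTerm-cong : ∀ C {A B} {f f' : Term A B} → f ≈ f' → plugTerm C f ≈ plugTerm C f'
plugTerm-cong ε p = p
plugTerm-cong (C ▸ M) p = plugTerm-cong C (⟪⟫-cong M p)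

plugTerm-∘ : ∀ C {A B D} {g : Term B D} {f : Term A B} → plugTerm C (g ∘ f) ≈ plugTerm C g ∘ plugTerm C f
plugTerm-∘ ε = ≈-refl
plugTerm-∘ (C ▸ M) = plugTerm-cong C (⟪⟫-∘ M) ⨾ plugTerm-∘ C

plugTerm-id : ∀ C A → plugTerm C (𝟏 A) ≈ 𝟏 (plug C A)
plugTerm-id ε A = ≈-refl
plugTerm-id (C ▸ M) A = plugTerm-cong C (fun-id M A) ⨾ plugTerm-id C (M ∷ A)

plugStep : ∀ C {A B} → Step Gen A B → Step Gen (plug C A) (plug C B)
plugStep ε s = s
plugStep (C ▸ M) s = plugStep C (under M s)

plugStep-sound : ∀ C {A B} (s : Step Gen A B) → stepTerm genTerm (plugStep C s) ≈ plugTerm C (stepTerm genTerm s)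
plugStep-sound ε s = ≈-refl
plugStep-sound (C ▸ M) s = plugStep-sound C (under M s)

actPlugged : ∀ {k A} C {B B'} → Gen B B' → NF k A (plug C B) → NF k A (plug C B')
actPlugged C g = actStep actGen (plugStep C (here g))

actPlugged-sound : ∀ {k A} C {B B'} (g : Gen B B') (n : NF k A (plug C B)) →
                   reify (actPlugged C g n) ≈ plugTerm C (genTerm g) ∘ reify n
actPlugged-sound C g n = actStep-sound actGen-sound (plugStep C (here g)) n ⨾ (plugStep-sound C _ ⟩∘ _)

actTerm : ∀ {k A} C {B B'} → Term B B' → NF k A (plug C B) → NF k A (plug C B')
actTerm C (𝟏 _) n = n
actTerm C (ε□ A) = actPlugged C (gε□ A)
actTerm C (ε◇ A) = actPlugged C (gε◇ A)
actTerm C (δ□□ A) = actPlugged C (gδ□ A)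
actTerm C (δ◇◇ A) = actPlugged C (gδ◇ A)
actTerm C (χ◇□ A) = actPlugged C (gχ A)
actTerm C (g ∘ f) n = actTerm C g (actTerm C f n)
actTerm C (⟪ M ⟫ f) n = actTerm (C ▸ M) f n

actTerm-sound : ∀ {k A} C {B B'} (f : Term B B') (n : NF k A (plug C B)) →
                reify (actTerm C f n) ≈ plugTerm C f ∘ reify n
actTerm-sound C (𝟏 _) n = ≈-sym ((plugTerm-id C _ ⟩∘ _) ⨾ idˡ _)
actTerm-sound C (ε□ A) = actPlugged-sound C (gε□ A)
actTerm-sound C (ε◇ A) = actPlugged-sound C (gε◇ A)
actTerm-sound C (δ□□ A) = actPlugged-sound C (gδ□ A)
actTerm-sound C (δ◇◇ A) = actPlugged-sound C (gδ◇ A)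
actTerm-sound C (χ◇□ A) = actPlugged-sound C (gχ A)
actTerm-sound C (g ∘ f) n =
  actTerm-sound C g _ ⨾ (_ ∘⟨ actTerm-sound C f n) ⨾ assocˡ ⨾ (≈-sym (plugTerm-∘ C) ⟩∘ _)
actTerm-sound C (⟪ M ⟫ f) n = actTerm-sound (C ▸ M) f n

idNF : ∀ A → NF 0 A A
idNF [] = nil
idNF (□ ∷ A) = keep□ (idNF A)
idNF (◇ ∷ A) = pend◇ (keep◇ (idNF A))

idNF-sound : ∀ A → reify (idNF A) ≈ 𝟏 A
idNF-sound [] = ≈-refl
idNF-sound (□ ∷ A) = idʳ _ ⨾ ⟪⟫-cong □ (idNF-sound A) ⨾ fun-id □ A
idNF-sound (◇ ∷ A) = idʳ _ ⨾ ⟪⟫-cong ◇ (idNF-sound A) ⨾ fun-id ◇ A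

nf : ∀ {A B} → Term A B → NF 0 A B
nf {A} f = actTerm ε f (idNF A)

nf-sound : ∀ {A B} (f : Term A B) → f ≈ reify (nf f)
nf-sound {A} f = ≈-sym (actTerm-sound ε f (idNF A) ⨾ (_ ∘⟨ idNF-sound A) ⨾ idʳ f)

≐-refl : ∀ {R} → R ≐ R
≐-refl i j = mk⇔ (λ x → x) (λ x → x)

≐-sym : ∀ {R S} → R ≐ S → S ≐ R
≐-sym p i j = mk⇔ (from (p i j)) (to (p i j))

≐-trans : ∀ {R S T} → R ≐ S → S ≐ T → R ≐ T
≐-trans p q i j = mk⇔ (λ x → to (q i j) (to (p i j) x)) (λ x → from (p i j) (from (q i j) x))

⊥-n<n : ∀ {n} {X : Set} → n < n → X
⊥-n<n {n} p = ⊥-elim (n≮n n p)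

⊥-1+n<n : ∀ {n} {X : Set} → suc n < n → X
⊥-1+n<n {n} p = ⊥-n<n (<-trans (n<1+n n) p)

⊥-2+n<n : ∀ {n} {X : Set} → suc (suc n) < n → X
⊥-2+n<n {n} p = ⊥-1+n<n (<-trans (n<1+n (suc n)) p)

⊥-1+n≡n : ∀ {n} {X : Set} → suc n ≡ n → X
⊥-1+n≡n p = ⊥-elim (1+n≢n p)

⊥-n≡1+n : ∀ {n} {X : Set} → n ≡ suc n → X
⊥-n≡1+n p = ⊥-1+n≡n (sym p)

⊥-2+n≡n : ∀ {n} {X : Set} → suc (suc n) ≡ n → X
⊥-2+n≡n p = ⊥-1+n<n (≤-reflexive p)

⊥-n≡2+n : ∀ {n} {X : Set} → n ≡ suc (suc n) → X
⊥-n≡2+n p = ⊥-2+n≡n (sym p)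

_∪_ : Rel₀ → Rel₀ → Rel₀
(R ∪ S) i j = R i j ⊎ S i j

[_↦_] : ℕ → ℕ → Rel₀
[ a ↦ b ] i j = i ≡ a × j ≡ b

_∩_ : Rel₀ → Rel₀ → Rel₀
(R ∩ S) i j = R i j × S i j

Dom< : ℕ → Rel₀
Dom< n i j = i < n

Cod< : ℕ → Rel₀
Cod< n i j = j < n

≐-reflexive : ∀ {R S} → R ≡ S → R ≐ S
≐-reflexive refl = ≐-refl

∪-comm : ∀ {R S} → (R ∪ S) ≐ (S ∪ R)
∪-comm i j = mk⇔ swap swap

∪-cong : ∀ {R R' S S'} → R ≐ R' → S ≐ S' → (R ∪ S) ≐ (R' ∪ S')
∪-cong p q i j = mk⇔ (⊎-map (to (p i j)) (to (q i j))) (⊎-map (from (p i j)) (from (q i j)))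

∩-cong : ∀ {R R' S S'} → R ≐ R' → S ≐ S' → (R ∩ S) ≐ (R' ∩ S')
∩-cong p q i j = mk⇔ (×-map (to (p i j)) (to (q i j))) (×-map (from (p i j)) (from (q i j)))

∪-∩-cancel : ∀ {R P Q} → R ⇒ Q → (∀ {i j} → P i j → Q i j → ⊥) → R ≐ ((R ∪ P) ∩ Q)
∪-∩-cancel R⇒Q disjoint i j = mk⇔ (λ r → inj₁ r , R⇒Q r) λ { (inj₁ r , _) → r ; (inj₂ p , q) → ⊥-elim (disjoint p q) }

∪-cancelˡ : ∀ {P R S} → (∀ {i j} → P i j → R i j → ⊥) → (∀ {i j} → P i j → S i j → ⊥) →
            (P ∪ R) ≐ (P ∪ S) → R ≐ S
∪-cancelˡ P#R P#S h i j = mk⇔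
  (λ r → [ (λ p → ⊥-elim (P#R p r)) , (λ s → s) ]′ (to (h i j) (inj₂ r)))
  (λ s → [ (λ p → ⊥-elim (P#S p s)) , (λ r → r) ]′ (from (h i j) (inj₂ s)))

↦#Dom< : ∀ {L b i j} → [ L ↦ b ] i j → Dom< L i j → ⊥
↦#Dom< (refl , _) = ⊥-n<n

↦#Cod< : ∀ {a b i j} → [ a ↦ b ] i j → Cod< b i j → ⊥
↦#Cod< (_ , refl) = ⊥-n<n

-- Shift a j i: position j becomes i when a new occurrence is inserted at position a.
Shift : ℕ → ℕ → ℕ → Set
Shift a j i = (j < a × i ≡ j) ⊎ (a ≤ j × i ≡ suc j)

ShiftBelow : ℕ → ℕ → Rel₀
ShiftBelow a y i j = Shift a j i × j < y

shift-exists : ∀ a j → Σ ℕ (Shift a j)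
shift-exists a j with <-cmp j a
... | tri< p _ _ = j , inj₁ (p , refl)
... | tri≈ _ refl _ = suc j , inj₂ (≤-refl , refl)
... | tri> _ _ p = suc j , inj₂ (<⇒≤ p , refl)

shift-injective : ∀ {a j j' i} → Shift a j i → Shift a j' i → j ≡ j'
shift-injective (inj₁ (_ , refl)) (inj₁ (_ , refl)) = refl
shift-injective (inj₁ (p , refl)) (inj₂ (q , e)) = ⊥-elim (<⇒≱ p (≤-trans (m≤n⇒m≤1+n q) (≤-reflexive (sym e))))
shift-injective (inj₂ (q , e)) (inj₁ (p , refl)) = ⊥-elim (<⇒≱ p (≤-trans (m≤n⇒m≤1+n q) (≤-reflexive (sym e))))
shift-injective (inj₂ (_ , refl)) (inj₂ (_ , e)) = suc-injective e

shift-misses : ∀ {a j} → ¬ Shift a j a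
shift-misses (inj₁ (p , refl)) = ⊥-n<n p
shift-misses (inj₂ (q , refl)) = ⊥-n<n q

shift-top : ∀ {a L i} → a ≤ L → Shift a L i → i ≡ suc L
shift-top le (inj₁ (p , _)) = ⊥-elim (<⇒≱ p le)
shift-top le (inj₂ (_ , e)) = e

shift-top⁻¹ : ∀ {a L j} → a ≤ L → Shift a j (suc L) → j ≡ L
shift-top⁻¹ le (inj₁ (p , refl)) = ⊥-elim (<⇒≱ p (m≤n⇒m≤1+n le))
shift-top⁻¹ le (inj₂ (_ , e)) = sym (suc-injective e)

shift-< : ∀ {a L j i} → Shift a j i → j < L → i < suc L
shift-< (inj₁ (_ , refl)) p = m<n⇒m<1+n p
shift-< (inj₂ (_ , refl)) p = s≤s p

shift-<⁻¹ : ∀ {a L j i} → Shift a j i → i < suc L → a ≤ L → j < L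
shift-<⁻¹ (inj₁ (p , refl)) q le = <-≤-trans p le
shift-<⁻¹ (inj₂ (_ , refl)) (s≤s q) le = q

Shifted : ℕ → Rel₀ → Rel₀
Shifted a R i j = Σ ℕ λ i' → Shift a i' i × R i' j

↦#Shifted : ∀ {a b R i j} → [ a ↦ b ] i j → Shifted a R i j → ⊥
↦#Shifted (refl , _) (_ , sh , _) = shift-misses sh

Shifted-cong : ∀ {a R S} → R ≐ S → Shifted a R ≐ Shifted a S
Shifted-cong p i j = mk⇔ (λ (i' , sh , r) → i' , sh , to (p i' j) r) (λ (i' , sh , s) → i' , sh , from (p i' j) s)

Shifted-injective : ∀ {a R S} → Shifted a R ≐ Shifted a S → R ≐ S
Shifted-injective {a} {R} {S} h i' j = mk⇔ (unshift {R} {S} (to (h i j))) (unshift {S} {R} (from (h i j)))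
  where
  i : ℕ
  i = proj₁ (shift-exists a i')
  sh : Shift a i' i
  sh = proj₂ (shift-exists a i')
  unshift : ∀ {P Q} → (Shifted a P i j → Shifted a Q i j) → P i' j → Q i' j
  unshift {Q = Q} f r with f (i' , sh , r)
  ... | i'' , sh'' , s = subst (λ z → Q z j) (shift-injective sh'' sh) s

Shifted-∩-Dom< : ∀ {a L R} → a ≤ L → Shifted a (R ∩ Dom< L) ≐ (Shifted a R ∩ Dom< (suc L))
Shifted-∩-Dom< a≤L i j = mk⇔
  (λ (i' , sh , r , lt) → (i' , sh , r) , shift-< sh lt)
  (λ ((i' , sh , r) , lt) → i' , sh , r , shift-<⁻¹ sh lt a≤L)

Shifted-∪-↦ : ∀ {a L b R} → a ≤ L → Shifted a (R ∪ [ L ↦ b ]) ≐ (Shifted a R ∪ [ suc L ↦ b ])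
Shifted-∪-↦ {L = L} a≤L i j = mk⇔
  (λ { (i' , sh , inj₁ r) → inj₁ (i' , sh , r) ; (i' , sh , inj₂ (refl , refl)) → inj₂ (shift-top a≤L sh , refl) })
  (λ { (inj₁ (i' , sh , r)) → i' , sh , inj₁ r ; (inj₂ (refl , refl)) → L , inj₂ (a≤L , refl) , inj₂ (refl , refl) })

-- The functor G respects the equations

G-bounded : ∀ {A B} (f : Term A B) {i j} → G f i j → i < length A × j < length B
G-bounded (𝟏 A) (refl , p) = p , p
G-bounded (ε□ A) (refl , p) = m<n⇒m<1+n p , p
G-bounded (ε◇ A) (refl , p) = p , m<n⇒m<1+n p
G-bounded (δ□□ A) (inj₁ (refl , p)) = m<n⇒m<1+n p , m<n⇒m<1+n (m<n⇒m<1+n p)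
G-bounded (δ□□ A) (inj₂ (inj₁ (refl , refl))) = n<1+n _ , m<n⇒m<1+n (n<1+n _)
G-bounded (δ□□ A) (inj₂ (inj₂ (refl , refl))) = n<1+n _ , n<1+n _
G-bounded (δ◇◇ A) (inj₁ (refl , p)) = m<n⇒m<1+n (m<n⇒m<1+n p) , m<n⇒m<1+n p
G-bounded (δ◇◇ A) (inj₂ (inj₁ (refl , refl))) = m<n⇒m<1+n (n<1+n _) , n<1+n _
G-bounded (δ◇◇ A) (inj₂ (inj₂ (refl , refl))) = n<1+n _ , n<1+n _
G-bounded (χ◇□ A) (inj₁ (refl , p)) = m<n⇒m<1+n (m<n⇒m<1+n p) , m<n⇒m<1+n (m<n⇒m<1+n p)
G-bounded (χ◇□ A) (inj₂ (inj₁ (refl , refl))) = m<n⇒m<1+n (n<1+n _) , n<1+n _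
G-bounded (χ◇□ A) (inj₂ (inj₂ (refl , refl))) = n<1+n _ , m<n⇒m<1+n (n<1+n _)
G-bounded (g ∘ f) (j , p , q) = proj₁ (G-bounded f p) , proj₂ (G-bounded g q)
G-bounded (⟪ M ⟫ f) (inj₁ p) = m<n⇒m<1+n (proj₁ (G-bounded f p)) , m<n⇒m<1+n (proj₂ (G-bounded f p))
G-bounded (⟪ M ⟫ f) (inj₂ (refl , refl)) = n<1+n _ , n<1+n _

G-dom : ∀ {A B} (f : Term A B) {i j} → G f i j → i < length A
G-dom f p = proj₁ (G-bounded f p)

G-cod : ∀ {A B} (f : Term A B) {i j} → G f i j → j < length B
G-cod f p = proj₂ (G-bounded f p)

G-idʳ : ∀ {A B} (f : Term A B) → G (f ∘ 𝟏 A) ≐ G f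
G-idʳ f i k = mk⇔ (λ { (j , (refl , _) , p) → p }) (λ p → i , (refl , G-dom f p) , p)

G-idˡ : ∀ {A B} (f : Term A B) → G (𝟏 B ∘ f) ≐ G f
G-idˡ f i k = mk⇔ (λ { (j , p , (refl , _)) → p }) (λ p → k , p , (refl , G-cod f p))

G-assoc : ∀ {A B C D} (f : Term A B) (g : Term B C) (h : Term C D) → G (h ∘ (g ∘ f)) ≐ G ((h ∘ g) ∘ f)
G-assoc f g h i l =
  mk⇔ (λ { (k , (j , p , q) , r) → j , p , (k , q , r) }) (λ { (j , p , (k , q , r)) → k , (j , p , q) , r })

G-fun-id : ∀ M A → G (⟪ M ⟫ (𝟏 A)) ≐ G (𝟏 (M ∷ A))
G-fun-id M A i j = mk⇔ forth back
  where
  forth : G (⟪ M ⟫ (𝟏 A)) i j → G (𝟏 (M ∷ A)) i j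
  forth (inj₁ (refl , p)) = refl , m<n⇒m<1+n p
  forth (inj₂ (refl , refl)) = refl , n<1+n _
  back : G (𝟏 (M ∷ A)) i j → G (⟪ M ⟫ (𝟏 A)) i j
  back (refl , p) with m<1+n⇒m<n∨m≡n p
  ... | inj₁ q = inj₁ (refl , q)
  ... | inj₂ refl = inj₂ (refl , refl)

G-fun-∘ : ∀ M {A B C} (f : Term A B) (g : Term B C) → G (⟪ M ⟫ (g ∘ f)) ≐ G (⟪ M ⟫ g ∘ ⟪ M ⟫ f)
G-fun-∘ M {B = B} f g i k = mk⇔ forth back
  where
  forth : G (⟪ M ⟫ (g ∘ f)) i k → G (⟪ M ⟫ g ∘ ⟪ M ⟫ f) i k
  forth (inj₁ (j , p , q)) = j , inj₁ p , inj₁ q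
  forth (inj₂ (refl , refl)) = length B , inj₂ (refl , refl) , inj₂ (refl , refl)
  back : G (⟪ M ⟫ g ∘ ⟪ M ⟫ f) i k → G (⟪ M ⟫ (g ∘ f)) i k
  back (j , inj₁ p , inj₁ q) = inj₁ (j , p , q)
  back (j , inj₁ p , inj₂ (refl , refl)) = ⊥-n<n (G-cod f p)
  back (j , inj₂ (refl , refl) , inj₁ q) = ⊥-n<n (G-dom g q)
  back (j , inj₂ (refl , refl) , inj₂ (_ , refl)) = inj₂ (refl , refl)

G-nat-ε□ : ∀ {A B} (f : Term A B) → G (ε□ B ∘ ⟪ □ ⟫ f) ≐ G (f ∘ ε□ A)
G-nat-ε□ {A} {B} f i k = mk⇔ forth back
  where
  forth : G (ε□ B ∘ ⟪ □ ⟫ f) i k → G (f ∘ ε□ A) i k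
  forth (j , inj₁ r , (refl , _)) = i , (refl , G-dom f r) , r
  forth (j , inj₂ (refl , refl) , (refl , p)) = ⊥-n<n p
  back : G (f ∘ ε□ A) i k → G (ε□ B ∘ ⟪ □ ⟫ f) i k
  back (j , (refl , _) , r) = k , inj₁ r , (refl , G-cod f r)

G-nat-δ□□ : ∀ {A B} (f : Term A B) → G (⟪ □ ⟫ (⟪ □ ⟫ f) ∘ δ□□ A) ≐ G (δ□□ B ∘ ⟪ □ ⟫ f)
G-nat-δ□□ {A} {B} f i k = mk⇔ forth back
  where
  forth : G (⟪ □ ⟫ (⟪ □ ⟫ f) ∘ δ□□ A) i k → G (δ□□ B ∘ ⟪ □ ⟫ f) i k
  forth (j , inj₁ (refl , p) , inj₁ (inj₁ r)) = k , inj₁ r , inj₁ (refl , G-cod f r)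
  forth (j , inj₁ (refl , p) , inj₁ (inj₂ (refl , refl))) = ⊥-n<n p
  forth (j , inj₁ (refl , p) , inj₂ (refl , refl)) = ⊥-1+n<n p
  forth (j , inj₂ (inj₁ (refl , refl)) , inj₁ (inj₁ r)) = ⊥-n<n (G-dom f r)
  forth (j , inj₂ (inj₁ (refl , refl)) , inj₁ (inj₂ (refl , refl))) =
    length B , inj₂ (refl , refl) , inj₂ (inj₁ (refl , refl))
  forth (j , inj₂ (inj₁ (refl , refl)) , inj₂ (e , refl)) = ⊥-n≡1+n e
  forth (j , inj₂ (inj₂ (refl , refl)) , inj₁ (inj₁ r)) = ⊥-1+n<n (G-dom f r)
  forth (j , inj₂ (inj₂ (refl , refl)) , inj₁ (inj₂ (e , refl))) = ⊥-1+n≡n e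
  forth (j , inj₂ (inj₂ (refl , refl)) , inj₂ (refl , refl)) =
    length B , inj₂ (refl , refl) , inj₂ (inj₂ (refl , refl))
  back : G (δ□□ B ∘ ⟪ □ ⟫ f) i k → G (⟪ □ ⟫ (⟪ □ ⟫ f) ∘ δ□□ A) i k
  back (j , inj₁ r , inj₁ (refl , _)) = i , inj₁ (refl , G-dom f r) , inj₁ (inj₁ r)
  back (j , inj₁ r , inj₂ (inj₁ (refl , refl))) = ⊥-n<n (G-cod f r)
  back (j , inj₁ r , inj₂ (inj₂ (refl , refl))) = ⊥-n<n (G-cod f r)
  back (j , inj₂ (refl , refl) , inj₁ (refl , p)) = ⊥-n<n p
  back (j , inj₂ (refl , refl) , inj₂ (inj₁ (refl , refl))) =
    length A , inj₂ (inj₁ (refl , refl)) , inj₁ (inj₂ (refl , refl))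
  back (j , inj₂ (refl , refl) , inj₂ (inj₂ (refl , refl))) =
    suc (length A) , inj₂ (inj₂ (refl , refl)) , inj₂ (refl , refl)

G-nat-ε◇ : ∀ {A B} (f : Term A B) → G (⟪ ◇ ⟫ f ∘ ε◇ A) ≐ G (ε◇ B ∘ f)
G-nat-ε◇ {A} {B} f i k = mk⇔ forth back
  where
  forth : G (⟪ ◇ ⟫ f ∘ ε◇ A) i k → G (ε◇ B ∘ f) i k
  forth (j , (refl , _) , inj₁ r) = k , r , (refl , G-cod f r)
  forth (j , (refl , p) , inj₂ (refl , refl)) = ⊥-n<n p
  back : G (ε◇ B ∘ f) i k → G (⟪ ◇ ⟫ f ∘ ε◇ A) i k
  back (j , r , (refl , _)) = i , (refl , G-dom f r) , inj₁ r

G-nat-δ◇◇ : ∀ {A B} (f : Term A B) → G (δ◇◇ B ∘ ⟪ ◇ ⟫ (⟪ ◇ ⟫ f)) ≐ G (⟪ ◇ ⟫ f ∘ δ◇◇ A)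
G-nat-δ◇◇ {A} {B} f i k = mk⇔ forth back
  where
  forth : G (δ◇◇ B ∘ ⟪ ◇ ⟫ (⟪ ◇ ⟫ f)) i k → G (⟪ ◇ ⟫ f ∘ δ◇◇ A) i k
  forth (j , inj₁ (inj₁ r) , inj₁ (refl , _)) = i , inj₁ (refl , G-dom f r) , inj₁ r
  forth (j , inj₁ (inj₁ r) , inj₂ (inj₁ (refl , refl))) = ⊥-n<n (G-cod f r)
  forth (j , inj₁ (inj₁ r) , inj₂ (inj₂ (refl , refl))) = ⊥-1+n<n (G-cod f r)
  forth (j , inj₁ (inj₂ (refl , refl)) , inj₁ (refl , p)) = ⊥-n<n p
  forth (j , inj₁ (inj₂ (refl , refl)) , inj₂ (inj₁ (refl , refl))) =
    length A , inj₂ (inj₁ (refl , refl)) , inj₂ (refl , refl)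
  forth (j , inj₁ (inj₂ (refl , refl)) , inj₂ (inj₂ (e , refl))) = ⊥-n≡1+n e
  forth (j , inj₂ (refl , refl) , inj₁ (refl , p)) = ⊥-1+n<n p
  forth (j , inj₂ (refl , refl) , inj₂ (inj₁ (e , refl))) = ⊥-1+n≡n e
  forth (j , inj₂ (refl , refl) , inj₂ (inj₂ (refl , refl))) =
    length A , inj₂ (inj₂ (refl , refl)) , inj₂ (refl , refl)
  back : G (⟪ ◇ ⟫ f ∘ δ◇◇ A) i k → G (δ◇◇ B ∘ ⟪ ◇ ⟫ (⟪ ◇ ⟫ f)) i k
  back (j , inj₁ (refl , p) , inj₁ r) = k , inj₁ (inj₁ r) , inj₁ (refl , G-cod f r)
  back (j , inj₁ (refl , p) , inj₂ (refl , refl)) = ⊥-n<n p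
  back (j , inj₂ (inj₁ (refl , refl)) , inj₁ r) = ⊥-n<n (G-dom f r)
  back (j , inj₂ (inj₁ (refl , refl)) , inj₂ (refl , refl)) =
    length B , inj₁ (inj₂ (refl , refl)) , inj₂ (inj₁ (refl , refl))
  back (j , inj₂ (inj₂ (refl , refl)) , inj₁ r) = ⊥-n<n (G-dom f r)
  back (j , inj₂ (inj₂ (refl , refl)) , inj₂ (e , refl)) =
    suc (length B) , inj₂ (refl , refl) , inj₂ (inj₂ (refl , refl))

G-com-δ : ∀ A → G (⟪ □ ⟫ (δ□□ A) ∘ δ□□ A) ≐ G (δ□□ (□ ∷ A) ∘ δ□□ A)
G-com-δ A i k = mk⇔ forth back
  where
  n : ℕ
  n = length A
  forth : G (⟪ □ ⟫ (δ□□ A) ∘ δ□□ A) i k → G (δ□□ (□ ∷ A) ∘ δ□□ A) i k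
  forth (j , inj₁ (refl , p) , inj₁ (inj₁ (refl , _))) = i , inj₁ (refl , p) , inj₁ (refl , m<n⇒m<1+n p)
  forth (j , inj₁ (refl , p) , inj₁ (inj₂ (inj₁ (refl , refl)))) = ⊥-n<n p
  forth (j , inj₁ (refl , p) , inj₁ (inj₂ (inj₂ (refl , refl)))) = ⊥-n<n p
  forth (j , inj₁ (refl , p) , inj₂ (refl , refl)) = ⊥-1+n<n p
  forth (j , inj₂ (inj₁ (refl , refl)) , inj₁ (inj₁ (refl , p))) = ⊥-n<n p
  forth (j , inj₂ (inj₁ (refl , refl)) , inj₁ (inj₂ (inj₁ (refl , refl)))) =
    n , inj₂ (inj₁ (refl , refl)) , inj₁ (refl , n<1+n n)
  forth (j , inj₂ (inj₁ (refl , refl)) , inj₁ (inj₂ (inj₂ (refl , refl)))) =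
    suc n , inj₂ (inj₂ (refl , refl)) , inj₂ (inj₁ (refl , refl))
  forth (j , inj₂ (inj₁ (refl , refl)) , inj₂ (e , refl)) = ⊥-n≡1+n e
  forth (j , inj₂ (inj₂ (refl , refl)) , inj₁ (inj₁ (refl , p))) = ⊥-1+n<n p
  forth (j , inj₂ (inj₂ (refl , refl)) , inj₁ (inj₂ (inj₁ (e , refl)))) = ⊥-1+n≡n e
  forth (j , inj₂ (inj₂ (refl , refl)) , inj₁ (inj₂ (inj₂ (e , refl)))) = ⊥-1+n≡n e
  forth (j , inj₂ (inj₂ (refl , refl)) , inj₂ (refl , refl)) =
    suc n , inj₂ (inj₂ (refl , refl)) , inj₂ (inj₂ (refl , refl))
  back : G (δ□□ (□ ∷ A) ∘ δ□□ A) i k → G (⟪ □ ⟫ (δ□□ A) ∘ δ□□ A) i k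
  back (j , inj₁ (refl , p) , inj₁ (refl , _)) = i , inj₁ (refl , p) , inj₁ (inj₁ (refl , p))
  back (j , inj₁ (refl , p) , inj₂ (inj₁ (refl , refl))) = ⊥-1+n<n p
  back (j , inj₁ (refl , p) , inj₂ (inj₂ (refl , refl))) = ⊥-1+n<n p
  back (j , inj₂ (inj₁ (refl , refl)) , inj₁ (refl , _)) =
    n , inj₂ (inj₁ (refl , refl)) , inj₁ (inj₂ (inj₁ (refl , refl)))
  back (j , inj₂ (inj₁ (refl , refl)) , inj₂ (inj₁ (e , refl))) = ⊥-n≡1+n e
  back (j , inj₂ (inj₁ (refl , refl)) , inj₂ (inj₂ (e , refl))) = ⊥-n≡1+n e
  back (j , inj₂ (inj₂ (refl , refl)) , inj₁ (refl , p)) = ⊥-n<n p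
  back (j , inj₂ (inj₂ (refl , refl)) , inj₂ (inj₁ (refl , refl))) =
    n , inj₂ (inj₁ (refl , refl)) , inj₁ (inj₂ (inj₂ (refl , refl)))
  back (j , inj₂ (inj₂ (refl , refl)) , inj₂ (inj₂ (refl , refl))) =
    suc n , inj₂ (inj₂ (refl , refl)) , inj₂ (refl , refl)

G-com-εδ : ∀ A → G (ε□ (□ ∷ A) ∘ δ□□ A) ≐ G (𝟏 (□ ∷ A))
G-com-εδ A i k = mk⇔ forth back
  where
  n : ℕ
  n = length A
  forth : G (ε□ (□ ∷ A) ∘ δ□□ A) i k → G (𝟏 (□ ∷ A)) i k
  forth (j , inj₁ (refl , p) , (refl , _)) = refl , m<n⇒m<1+n p
  forth (j , inj₂ (inj₁ (refl , refl)) , (refl , _)) = refl , n<1+n n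
  forth (j , inj₂ (inj₂ (refl , refl)) , (refl , p)) = ⊥-n<n p
  back : G (𝟏 (□ ∷ A)) i k → G (ε□ (□ ∷ A) ∘ δ□□ A) i k
  back (refl , p) with m<1+n⇒m<n∨m≡n p
  ... | inj₁ q = i , inj₁ (refl , q) , (refl , p)
  ... | inj₂ refl = n , inj₂ (inj₁ (refl , refl)) , (refl , n<1+n n)

G-com-□εδ : ∀ A → G (⟪ □ ⟫ (ε□ A) ∘ δ□□ A) ≐ G (𝟏 (□ ∷ A))
G-com-□εδ A i k = mk⇔ forth back
  where
  n : ℕ
  n = length A
  forth : G (⟪ □ ⟫ (ε□ A) ∘ δ□□ A) i k → G (𝟏 (□ ∷ A)) i k
  forth (j , inj₁ (refl , p) , inj₁ (refl , _)) = refl , m<n⇒m<1+n p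
  forth (j , inj₁ (refl , p) , inj₂ (refl , refl)) = ⊥-1+n<n p
  forth (j , inj₂ (inj₁ (refl , refl)) , inj₁ (refl , p)) = ⊥-n<n p
  forth (j , inj₂ (inj₁ (refl , refl)) , inj₂ (e , refl)) = ⊥-n≡1+n e
  forth (j , inj₂ (inj₂ (refl , refl)) , inj₁ (refl , p)) = ⊥-1+n<n p
  forth (j , inj₂ (inj₂ (refl , refl)) , inj₂ (refl , refl)) = refl , n<1+n n
  back : G (𝟏 (□ ∷ A)) i k → G (⟪ □ ⟫ (ε□ A) ∘ δ□□ A) i k
  back (refl , p) with m<1+n⇒m<n∨m≡n p
  ... | inj₁ q = i , inj₁ (refl , q) , inj₁ (refl , q)
  ... | inj₂ refl = suc n , inj₂ (inj₂ (refl , refl)) , inj₂ (refl , refl)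

G-mon-δ : ∀ A → G (δ◇◇ A ∘ ⟪ ◇ ⟫ (δ◇◇ A)) ≐ G (δ◇◇ A ∘ δ◇◇ (◇ ∷ A))
G-mon-δ A i k = mk⇔ forth back
  where
  n : ℕ
  n = length A
  forth : G (δ◇◇ A ∘ ⟪ ◇ ⟫ (δ◇◇ A)) i k → G (δ◇◇ A ∘ δ◇◇ (◇ ∷ A)) i k
  forth (j , inj₁ (inj₁ (refl , p)) , inj₁ (refl , _)) = i , inj₁ (refl , m<n⇒m<1+n p) , inj₁ (refl , p)
  forth (j , inj₁ (inj₁ (refl , p)) , inj₂ (inj₁ (refl , refl))) = ⊥-n<n p
  forth (j , inj₁ (inj₁ (refl , p)) , inj₂ (inj₂ (refl , refl))) = ⊥-1+n<n p
  forth (j , inj₁ (inj₂ (inj₁ (refl , refl))) , inj₁ (refl , p)) = ⊥-n<n p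
  forth (j , inj₁ (inj₂ (inj₁ (refl , refl))) , inj₂ (inj₁ (refl , refl))) =
    n , inj₁ (refl , n<1+n n) , inj₂ (inj₁ (refl , refl))
  forth (j , inj₁ (inj₂ (inj₁ (refl , refl))) , inj₂ (inj₂ (e , refl))) = ⊥-n≡1+n e
  forth (j , inj₁ (inj₂ (inj₂ (refl , refl))) , inj₁ (refl , p)) = ⊥-n<n p
  forth (j , inj₁ (inj₂ (inj₂ (refl , refl))) , inj₂ (inj₁ (refl , refl))) =
    suc n , inj₂ (inj₁ (refl , refl)) , inj₂ (inj₂ (refl , refl))
  forth (j , inj₁ (inj₂ (inj₂ (refl , refl))) , inj₂ (inj₂ (e , refl))) = ⊥-n≡1+n e
  forth (j , inj₂ (refl , refl) , inj₁ (refl , p)) = ⊥-1+n<n p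
  forth (j , inj₂ (refl , refl) , inj₂ (inj₁ (e , refl))) = ⊥-1+n≡n e
  forth (j , inj₂ (refl , refl) , inj₂ (inj₂ (refl , refl))) =
    suc n , inj₂ (inj₂ (refl , refl)) , inj₂ (inj₂ (refl , refl))
  back : G (δ◇◇ A ∘ δ◇◇ (◇ ∷ A)) i k → G (δ◇◇ A ∘ ⟪ ◇ ⟫ (δ◇◇ A)) i k
  back (j , inj₁ (refl , p) , inj₁ (refl , q)) = i , inj₁ (inj₁ (refl , q)) , inj₁ (refl , q)
  back (j , inj₁ (refl , p) , inj₂ (inj₁ (refl , refl))) =
    n , inj₁ (inj₂ (inj₁ (refl , refl))) , inj₂ (inj₁ (refl , refl))
  back (j , inj₁ (refl , p) , inj₂ (inj₂ (refl , refl))) = ⊥-n<n p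
  back (j , inj₂ (inj₁ (refl , refl)) , inj₁ (refl , p)) = ⊥-1+n<n p
  back (j , inj₂ (inj₁ (refl , refl)) , inj₂ (inj₁ (e , refl))) = ⊥-1+n≡n e
  back (j , inj₂ (inj₁ (refl , refl)) , inj₂ (inj₂ (refl , refl))) =
    n , inj₁ (inj₂ (inj₂ (refl , refl))) , inj₂ (inj₁ (refl , refl))
  back (j , inj₂ (inj₂ (refl , refl)) , inj₁ (refl , p)) = ⊥-1+n<n p
  back (j , inj₂ (inj₂ (refl , refl)) , inj₂ (inj₁ (e , refl))) = ⊥-1+n≡n e
  back (j , inj₂ (inj₂ (refl , refl)) , inj₂ (inj₂ (refl , refl))) =
    suc n , inj₂ (refl , refl) , inj₂ (inj₂ (refl , refl))

G-mon-δε : ∀ A → G (δ◇◇ A ∘ ε◇ (◇ ∷ A)) ≐ G (𝟏 (◇ ∷ A))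
G-mon-δε A i k = mk⇔ forth back
  where
  n : ℕ
  n = length A
  forth : G (δ◇◇ A ∘ ε◇ (◇ ∷ A)) i k → G (𝟏 (◇ ∷ A)) i k
  forth (j , (refl , p) , inj₁ (refl , q)) = refl , m<n⇒m<1+n q
  forth (j , (refl , p) , inj₂ (inj₁ (refl , refl))) = refl , n<1+n n
  forth (j , (refl , p) , inj₂ (inj₂ (refl , refl))) = ⊥-n<n p
  back : G (𝟏 (◇ ∷ A)) i k → G (δ◇◇ A ∘ ε◇ (◇ ∷ A)) i k
  back (refl , p) with m<1+n⇒m<n∨m≡n p
  ... | inj₁ q = i , (refl , p) , inj₁ (refl , q)
  ... | inj₂ refl = n , (refl , p) , inj₂ (inj₁ (refl , refl))

G-mon-δ◇ε : ∀ A → G (δ◇◇ A ∘ ⟪ ◇ ⟫ (ε◇ A)) ≐ G (𝟏 (◇ ∷ A))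
G-mon-δ◇ε A i k = mk⇔ forth back
  where
  n : ℕ
  n = length A
  forth : G (δ◇◇ A ∘ ⟪ ◇ ⟫ (ε◇ A)) i k → G (𝟏 (◇ ∷ A)) i k
  forth (j , inj₁ (refl , p) , inj₁ (refl , _)) = refl , m<n⇒m<1+n p
  forth (j , inj₁ (refl , p) , inj₂ (inj₁ (refl , refl))) = ⊥-n<n p
  forth (j , inj₁ (refl , p) , inj₂ (inj₂ (refl , refl))) = ⊥-1+n<n p
  forth (j , inj₂ (refl , refl) , inj₁ (refl , p)) = ⊥-1+n<n p
  forth (j , inj₂ (refl , refl) , inj₂ (inj₁ (e , refl))) = ⊥-1+n≡n e
  forth (j , inj₂ (refl , refl) , inj₂ (inj₂ (refl , refl))) = refl , n<1+n n
  back : G (𝟏 (◇ ∷ A)) i k → G (δ◇◇ A ∘ ⟪ ◇ ⟫ (ε◇ A)) i k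
  back (refl , p) with m<1+n⇒m<n∨m≡n p
  ... | inj₁ q = i , inj₁ (refl , q) , inj₁ (refl , q)
  ... | inj₂ refl = suc n , inj₂ (refl , refl) , inj₂ (inj₂ (refl , refl))

G-nat-χ : ∀ {A B} (f : Term A B) → G (⟪ □ ⟫ (⟪ ◇ ⟫ f) ∘ χ◇□ A) ≐ G (χ◇□ B ∘ ⟪ ◇ ⟫ (⟪ □ ⟫ f))
G-nat-χ {A} {B} f i k = mk⇔ forth back
  where
  a : ℕ
  a = length A
  b : ℕ
  b = length B
  forth : G (⟪ □ ⟫ (⟪ ◇ ⟫ f) ∘ χ◇□ A) i k → G (χ◇□ B ∘ ⟪ ◇ ⟫ (⟪ □ ⟫ f)) i k
  forth (j , inj₁ (refl , p) , inj₁ (inj₁ r)) = k , inj₁ (inj₁ r) , inj₁ (refl , G-cod f r)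
  forth (j , inj₁ (refl , p) , inj₁ (inj₂ (refl , refl))) = ⊥-n<n p
  forth (j , inj₁ (refl , p) , inj₂ (refl , refl)) = ⊥-1+n<n p
  forth (j , inj₂ (inj₁ (refl , refl)) , inj₁ (inj₁ r)) = ⊥-1+n<n (G-dom f r)
  forth (j , inj₂ (inj₁ (refl , refl)) , inj₁ (inj₂ (e , refl))) = ⊥-1+n≡n e
  forth (j , inj₂ (inj₁ (refl , refl)) , inj₂ (refl , refl)) =
    b , inj₁ (inj₂ (refl , refl)) , inj₂ (inj₁ (refl , refl))
  forth (j , inj₂ (inj₂ (refl , refl)) , inj₁ (inj₁ r)) = ⊥-n<n (G-dom f r)
  forth (j , inj₂ (inj₂ (refl , refl)) , inj₁ (inj₂ (refl , refl))) =
    suc b , inj₂ (refl , refl) , inj₂ (inj₂ (refl , refl))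
  forth (j , inj₂ (inj₂ (refl , refl)) , inj₂ (e , refl)) = ⊥-n≡1+n e
  back : G (χ◇□ B ∘ ⟪ ◇ ⟫ (⟪ □ ⟫ f)) i k → G (⟪ □ ⟫ (⟪ ◇ ⟫ f) ∘ χ◇□ A) i k
  back (j , inj₁ (inj₁ r) , inj₁ (refl , p)) = i , inj₁ (refl , G-dom f r) , inj₁ (inj₁ r)
  back (j , inj₁ (inj₁ r) , inj₂ (inj₁ (refl , refl))) = ⊥-n<n (G-cod f r)
  back (j , inj₁ (inj₁ r) , inj₂ (inj₂ (refl , refl))) = ⊥-1+n<n (G-cod f r)
  back (j , inj₁ (inj₂ (refl , refl)) , inj₁ (refl , p)) = ⊥-n<n p
  back (j , inj₁ (inj₂ (refl , refl)) , inj₂ (inj₁ (refl , refl))) =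
    suc a , inj₂ (inj₁ (refl , refl)) , inj₂ (refl , refl)
  back (j , inj₁ (inj₂ (refl , refl)) , inj₂ (inj₂ (e , refl))) = ⊥-n≡1+n e
  back (j , inj₂ (refl , refl) , inj₁ (refl , p)) = ⊥-1+n<n p
  back (j , inj₂ (refl , refl) , inj₂ (inj₁ (e , refl))) = ⊥-1+n≡n e
  back (j , inj₂ (refl , refl) , inj₂ (inj₂ (refl , refl))) =
    a , inj₂ (inj₂ (refl , refl)) , inj₁ (inj₂ (refl , refl))

G-χ-ε□ : ∀ A → G (ε□ (◇ ∷ A) ∘ χ◇□ A) ≐ G (⟪ ◇ ⟫ (ε□ A))
G-χ-ε□ A i k = mk⇔ forth back
  where
  n : ℕ
  n = length A
  forth : G (ε□ (◇ ∷ A) ∘ χ◇□ A) i k → G (⟪ ◇ ⟫ (ε□ A)) i k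
  forth (j , inj₁ (refl , p) , (refl , _)) = inj₁ (refl , p)
  forth (j , inj₂ (inj₁ (refl , refl)) , (refl , p)) = ⊥-n<n p
  forth (j , inj₂ (inj₂ (refl , refl)) , (refl , _)) = inj₂ (refl , refl)
  back : G (⟪ ◇ ⟫ (ε□ A)) i k → G (ε□ (◇ ∷ A) ∘ χ◇□ A) i k
  back (inj₁ (refl , p)) = i , inj₁ (refl , p) , (refl , m<n⇒m<1+n p)
  back (inj₂ (refl , refl)) = n , inj₂ (inj₂ (refl , refl)) , (refl , n<1+n n)

G-χ-ε◇ : ∀ A → G (χ◇□ A ∘ ε◇ (□ ∷ A)) ≐ G (⟪ □ ⟫ (ε◇ A))
G-χ-ε◇ A i k = mk⇔ forth back
  where
  n : ℕ
  n = length A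
  forth : G (χ◇□ A ∘ ε◇ (□ ∷ A)) i k → G (⟪ □ ⟫ (ε◇ A)) i k
  forth (j , (refl , p) , inj₁ (refl , q)) = inj₁ (refl , q)
  forth (j , (refl , p) , inj₂ (inj₁ (refl , refl))) = inj₂ (refl , refl)
  forth (j , (refl , p) , inj₂ (inj₂ (refl , refl))) = ⊥-n<n p
  back : G (⟪ □ ⟫ (ε◇ A)) i k → G (χ◇□ A ∘ ε◇ (□ ∷ A)) i k
  back (inj₁ (refl , q)) = i , (refl , m<n⇒m<1+n q) , inj₁ (refl , q)
  back (inj₂ (refl , refl)) = n , (refl , n<1+n n) , inj₂ (inj₁ (refl , refl))

G-χ-δ□□⊆ : ∀ A →
  G (δ□□ (◇ ∷ A) ∘ χ◇□ A) ⇒ G ((⟪ □ ⟫ (χ◇□ A) ∘ χ◇□ (□ ∷ A)) ∘ ⟪ ◇ ⟫ (δ□□ A))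
G-χ-δ□□⊆ A {i} (j , inj₁ (refl , p) , inj₁ (refl , _)) =
  i , inj₁ (inj₁ (refl , p)) , (i , inj₁ (refl , m<n⇒m<1+n p) , inj₁ (inj₁ (refl , p)))
G-χ-δ□□⊆ A (j , inj₁ (refl , p) , inj₂ (inj₁ (refl , refl))) = ⊥-1+n<n p
G-χ-δ□□⊆ A (j , inj₁ (refl , p) , inj₂ (inj₂ (refl , refl))) = ⊥-1+n<n p
G-χ-δ□□⊆ A (j , inj₂ (inj₁ (refl , refl)) , inj₁ (refl , p)) = ⊥-n<n p
G-χ-δ□□⊆ A (j , inj₂ (inj₁ (refl , refl)) , inj₂ (inj₁ (refl , refl))) =
  length A , inj₁ (inj₂ (inj₁ (refl , refl))) , (length A , inj₁ (refl , n<1+n (length A)) , inj₁ (inj₂ (inj₁ (refl , refl))))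
G-χ-δ□□⊆ A (j , inj₂ (inj₁ (refl , refl)) , inj₂ (inj₂ (refl , refl))) =
  suc (length A) , inj₁ (inj₂ (inj₂ (refl , refl))) , (suc (suc (length A)) , inj₂ (inj₁ (refl , refl)) , inj₂ (refl , refl))
G-χ-δ□□⊆ A (j , inj₂ (inj₂ (refl , refl)) , inj₁ (refl , p)) =
  suc (suc (length A)) , inj₂ (refl , refl) , (suc (length A) , inj₂ (inj₂ (refl , refl)) , inj₁ (inj₂ (inj₂ (refl , refl))))
G-χ-δ□□⊆ A (j , inj₂ (inj₂ (refl , refl)) , inj₂ (inj₁ (e , refl))) = ⊥-n≡1+n e
G-χ-δ□□⊆ A (j , inj₂ (inj₂ (refl , refl)) , inj₂ (inj₂ (e , refl))) = ⊥-n≡1+n e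

G-χ-δ□□⊇ : ∀ A →
  G ((⟪ □ ⟫ (χ◇□ A) ∘ χ◇□ (□ ∷ A)) ∘ ⟪ ◇ ⟫ (δ□□ A)) ⇒ G (δ□□ (◇ ∷ A) ∘ χ◇□ A)
G-χ-δ□□⊇ A (j , inj₁ (inj₁ (refl , p)) , (k , inj₁ (refl , _) , inj₁ (inj₁ (refl , _)))) =
  j , inj₁ (refl , p) , inj₁ (refl , m<n⇒m<1+n p)
G-χ-δ□□⊇ A (j , inj₁ (inj₁ (refl , p)) , (k , inj₁ (refl , _) , inj₁ (inj₂ (inj₁ (refl , refl))))) = ⊥-n<n p
G-χ-δ□□⊇ A (j , inj₁ (inj₁ (refl , p)) , (k , inj₁ (refl , _) , inj₁ (inj₂ (inj₂ (refl , refl))))) = ⊥-1+n<n p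
G-χ-δ□□⊇ A (j , inj₁ (inj₁ (refl , p)) , (k , inj₁ (refl , _) , inj₂ (refl , refl))) = ⊥-2+n<n p
G-χ-δ□□⊇ A (j , inj₁ (inj₁ (refl , p)) , (k , inj₂ (inj₁ (refl , refl)) , _)) = ⊥-1+n<n p
G-χ-δ□□⊇ A (j , inj₁ (inj₁ (refl , p)) , (k , inj₂ (inj₂ (refl , refl)) , _)) = ⊥-2+n<n p
G-χ-δ□□⊇ A (j , inj₁ (inj₂ (inj₁ (refl , refl))) , (k , inj₁ (refl , _) , inj₁ (inj₁ (refl , p)))) = ⊥-n<n p
G-χ-δ□□⊇ A (j , inj₁ (inj₂ (inj₁ (refl , refl))) , (k , inj₁ (refl , _) , inj₁ (inj₂ (inj₁ (refl , refl))))) =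
  suc (length A) , inj₂ (inj₁ (refl , refl)) , inj₂ (inj₁ (refl , refl))
G-χ-δ□□⊇ A (j , inj₁ (inj₂ (inj₁ (refl , refl))) , (k , inj₁ (refl , _) , inj₁ (inj₂ (inj₂ (e , _))))) = ⊥-n≡1+n e
G-χ-δ□□⊇ A (j , inj₁ (inj₂ (inj₁ (refl , refl))) , (k , inj₁ (refl , _) , inj₂ (e , _))) = ⊥-n≡2+n e
G-χ-δ□□⊇ A (j , inj₁ (inj₂ (inj₁ (refl , refl))) , (k , inj₂ (inj₁ (e , _)) , _)) = ⊥-n≡1+n e
G-χ-δ□□⊇ A (j , inj₁ (inj₂ (inj₁ (refl , refl))) , (k , inj₂ (inj₂ (e , _)) , _)) = ⊥-n≡2+n e
G-χ-δ□□⊇ A (j , inj₁ (inj₂ (inj₂ (refl , refl))) , (k , inj₁ (refl , p) , _)) = ⊥-n<n p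
G-χ-δ□□⊇ A (j , inj₁ (inj₂ (inj₂ (refl , refl))) , (k , inj₂ (inj₁ (refl , refl)) , inj₁ (inj₁ (refl , p)))) = ⊥-2+n<n p
G-χ-δ□□⊇ A (j , inj₁ (inj₂ (inj₂ (refl , refl))) , (k , inj₂ (inj₁ (refl , refl)) , inj₁ (inj₂ (inj₁ (e , _))))) = ⊥-2+n≡n e
G-χ-δ□□⊇ A (j , inj₁ (inj₂ (inj₂ (refl , refl))) , (k , inj₂ (inj₁ (refl , refl)) , inj₁ (inj₂ (inj₂ (e , _))))) = ⊥-1+n≡n e
G-χ-δ□□⊇ A (j , inj₁ (inj₂ (inj₂ (refl , refl))) , (k , inj₂ (inj₁ (refl , refl)) , inj₂ (refl , refl))) =
  suc (length A) , inj₂ (inj₁ (refl , refl)) , inj₂ (inj₂ (refl , refl))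
G-χ-δ□□⊇ A (j , inj₁ (inj₂ (inj₂ (refl , refl))) , (k , inj₂ (inj₂ (e , _)) , _)) = ⊥-n≡1+n e
G-χ-δ□□⊇ A (j , inj₂ (refl , refl) , (k , inj₁ (refl , p) , _)) = ⊥-1+n<n p
G-χ-δ□□⊇ A (j , inj₂ (refl , refl) , (k , inj₂ (inj₁ (e , _)) , _)) = ⊥-1+n≡n e
G-χ-δ□□⊇ A (j , inj₂ (refl , refl) , (k , inj₂ (inj₂ (refl , refl)) , inj₁ (inj₁ (refl , p)))) = ⊥-1+n<n p
G-χ-δ□□⊇ A (j , inj₂ (refl , refl) , (k , inj₂ (inj₂ (refl , refl)) , inj₁ (inj₂ (inj₁ (e , _))))) = ⊥-1+n≡n e
G-χ-δ□□⊇ A (j , inj₂ (refl , refl) , (k , inj₂ (inj₂ (refl , refl)) , inj₁ (inj₂ (inj₂ (refl , refl))))) =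
  length A , inj₂ (inj₂ (refl , refl)) , inj₁ (refl , n<1+n (length A))
G-χ-δ□□⊇ A (j , inj₂ (refl , refl) , (k , inj₂ (inj₂ (refl , refl)) , inj₂ (e , _))) = ⊥-n≡1+n e

G-χ-δ□□ : ∀ A → G (δ□□ (◇ ∷ A) ∘ χ◇□ A) ≐ G ((⟪ □ ⟫ (χ◇□ A) ∘ χ◇□ (□ ∷ A)) ∘ ⟪ ◇ ⟫ (δ□□ A))
G-χ-δ□□ A i l = mk⇔ (G-χ-δ□□⊆ A) (G-χ-δ□□⊇ A)

G-χ-δ◇◇⊆ : ∀ A →
  G (χ◇□ A ∘ δ◇◇ (□ ∷ A)) ⇒ G ((⟪ □ ⟫ (δ◇◇ A) ∘ χ◇□ (◇ ∷ A)) ∘ ⟪ ◇ ⟫ (χ◇□ A))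
G-χ-δ◇◇⊆ A {i} (j , inj₁ (refl , p) , inj₁ (refl , q)) =
  i , inj₁ (inj₁ (refl , q)) , (i , inj₁ (refl , m<n⇒m<1+n q) , inj₁ (inj₁ (refl , q)))
G-χ-δ◇◇⊆ A (j , inj₁ (refl , p) , inj₂ (inj₁ (refl , refl))) =
  suc (length A) , inj₁ (inj₂ (inj₁ (refl , refl))) , (suc (suc (length A)) , inj₂ (inj₁ (refl , refl)) , inj₂ (refl , refl))
G-χ-δ◇◇⊆ A (j , inj₁ (refl , p) , inj₂ (inj₂ (refl , refl))) = ⊥-n<n p
G-χ-δ◇◇⊆ A (j , inj₂ (inj₁ (refl , refl)) , inj₁ (refl , q)) = ⊥-1+n<n q
G-χ-δ◇◇⊆ A (j , inj₂ (inj₁ (refl , refl)) , inj₂ (inj₁ (e , refl))) = ⊥-1+n≡n e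
G-χ-δ◇◇⊆ A (j , inj₂ (inj₁ (refl , refl)) , inj₂ (inj₂ (refl , refl))) =
  length A , inj₁ (inj₂ (inj₂ (refl , refl))) , (length A , inj₁ (refl , n<1+n (length A)) , inj₁ (inj₂ (inj₁ (refl , refl))))
G-χ-δ◇◇⊆ A (j , inj₂ (inj₂ (refl , refl)) , inj₁ (refl , q)) = ⊥-1+n<n q
G-χ-δ◇◇⊆ A (j , inj₂ (inj₂ (refl , refl)) , inj₂ (inj₁ (e , refl))) = ⊥-1+n≡n e
G-χ-δ◇◇⊆ A (j , inj₂ (inj₂ (refl , refl)) , inj₂ (inj₂ (refl , refl))) =
  suc (suc (length A)) , inj₂ (refl , refl) , (suc (length A) , inj₂ (inj₂ (refl , refl)) , inj₁ (inj₂ (inj₂ (refl , refl))))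

G-χ-δ◇◇⊇ : ∀ A →
  G ((⟪ □ ⟫ (δ◇◇ A) ∘ χ◇□ (◇ ∷ A)) ∘ ⟪ ◇ ⟫ (χ◇□ A)) ⇒ G (χ◇□ A ∘ δ◇◇ (□ ∷ A))
G-χ-δ◇◇⊇ A (j , inj₁ (inj₁ (refl , p)) , (k , inj₁ (refl , _) , inj₁ (inj₁ (refl , _)))) =
  j , inj₁ (refl , m<n⇒m<1+n p) , inj₁ (refl , p)
G-χ-δ◇◇⊇ A (j , inj₁ (inj₁ (refl , p)) , (k , inj₁ (refl , _) , inj₁ (inj₂ (inj₁ (refl , refl))))) = ⊥-n<n p
G-χ-δ◇◇⊇ A (j , inj₁ (inj₁ (refl , p)) , (k , inj₁ (refl , _) , inj₁ (inj₂ (inj₂ (refl , refl))))) = ⊥-1+n<n p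
G-χ-δ◇◇⊇ A (j , inj₁ (inj₁ (refl , p)) , (k , inj₁ (refl , _) , inj₂ (refl , refl))) = ⊥-2+n<n p
G-χ-δ◇◇⊇ A (j , inj₁ (inj₁ (refl , p)) , (k , inj₂ (inj₁ (refl , refl)) , _)) = ⊥-1+n<n p
G-χ-δ◇◇⊇ A (j , inj₁ (inj₁ (refl , p)) , (k , inj₂ (inj₂ (refl , refl)) , _)) = ⊥-2+n<n p
G-χ-δ◇◇⊇ A (j , inj₁ (inj₂ (inj₁ (refl , refl))) , (k , inj₁ (refl , p) , _)) = ⊥-n<n p
G-χ-δ◇◇⊇ A (j , inj₁ (inj₂ (inj₁ (refl , refl))) , (k , inj₂ (inj₁ (refl , refl)) , inj₁ (inj₁ (refl , p)))) = ⊥-2+n<n p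
G-χ-δ◇◇⊇ A (j , inj₁ (inj₂ (inj₁ (refl , refl))) , (k , inj₂ (inj₁ (refl , refl)) , inj₁ (inj₂ (inj₁ (e , _))))) = ⊥-2+n≡n e
G-χ-δ◇◇⊇ A (j , inj₁ (inj₂ (inj₁ (refl , refl))) , (k , inj₂ (inj₁ (refl , refl)) , inj₁ (inj₂ (inj₂ (e , _))))) = ⊥-1+n≡n e
G-χ-δ◇◇⊇ A (j , inj₁ (inj₂ (inj₁ (refl , refl))) , (k , inj₂ (inj₁ (refl , refl)) , inj₂ (refl , refl))) =
  length A , inj₁ (refl , n<1+n (length A)) , inj₂ (inj₁ (refl , refl))
G-χ-δ◇◇⊇ A (j , inj₁ (inj₂ (inj₁ (refl , refl))) , (k , inj₂ (inj₂ (e , _)) , _)) = ⊥-n≡1+n e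
G-χ-δ◇◇⊇ A (j , inj₁ (inj₂ (inj₂ (refl , refl))) , (k , inj₁ (refl , _) , inj₁ (inj₁ (refl , p)))) = ⊥-n<n p
G-χ-δ◇◇⊇ A (j , inj₁ (inj₂ (inj₂ (refl , refl))) , (k , inj₁ (refl , _) , inj₁ (inj₂ (inj₁ (refl , refl))))) =
  suc (length A) , inj₂ (inj₁ (refl , refl)) , inj₂ (inj₂ (refl , refl))
G-χ-δ◇◇⊇ A (j , inj₁ (inj₂ (inj₂ (refl , refl))) , (k , inj₁ (refl , _) , inj₁ (inj₂ (inj₂ (e , _))))) = ⊥-n≡1+n e
G-χ-δ◇◇⊇ A (j , inj₁ (inj₂ (inj₂ (refl , refl))) , (k , inj₁ (refl , _) , inj₂ (e , _))) = ⊥-n≡2+n e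
G-χ-δ◇◇⊇ A (j , inj₁ (inj₂ (inj₂ (refl , refl))) , (k , inj₂ (inj₁ (e , _)) , _)) = ⊥-n≡1+n e
G-χ-δ◇◇⊇ A (j , inj₁ (inj₂ (inj₂ (refl , refl))) , (k , inj₂ (inj₂ (e , _)) , _)) = ⊥-n≡2+n e
G-χ-δ◇◇⊇ A (j , inj₂ (refl , refl) , (k , inj₁ (refl , p) , _)) = ⊥-1+n<n p
G-χ-δ◇◇⊇ A (j , inj₂ (refl , refl) , (k , inj₂ (inj₁ (e , _)) , _)) = ⊥-1+n≡n e
G-χ-δ◇◇⊇ A (j , inj₂ (refl , refl) , (k , inj₂ (inj₂ (refl , refl)) , inj₁ (inj₁ (refl , p)))) = ⊥-1+n<n p
G-χ-δ◇◇⊇ A (j , inj₂ (refl , refl) , (k , inj₂ (inj₂ (refl , refl)) , inj₁ (inj₂ (inj₁ (e , _))))) = ⊥-1+n≡n e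
G-χ-δ◇◇⊇ A (j , inj₂ (refl , refl) , (k , inj₂ (inj₂ (refl , refl)) , inj₁ (inj₂ (inj₂ (refl , refl))))) =
  suc (length A) , inj₂ (inj₂ (refl , refl)) , inj₂ (inj₂ (refl , refl))
G-χ-δ◇◇⊇ A (j , inj₂ (refl , refl) , (k , inj₂ (inj₂ (refl , refl)) , inj₂ (e , _))) = ⊥-n≡1+n e

G-χ-δ◇◇ : ∀ A → G (χ◇□ A ∘ δ◇◇ (□ ∷ A)) ≐ G ((⟪ □ ⟫ (δ◇◇ A) ∘ χ◇□ (◇ ∷ A)) ∘ ⟪ ◇ ⟫ (χ◇□ A))
G-χ-δ◇◇ A i l = mk⇔ (G-χ-δ◇◇⊆ A) (G-χ-δ◇◇⊇ A)

G-resp-≈ : ∀ {A B} {f g : Term A B} → f ≈ g → G f ≐ G g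
G-resp-≈ ≈-refl = ≐-refl
G-resp-≈ (≈-sym p) = ≐-sym (G-resp-≈ p)
G-resp-≈ (≈-trans p q) = ≐-trans (G-resp-≈ p) (G-resp-≈ q)
G-resp-≈ (∘-cong p q) i k =
  mk⇔ (λ { (j , x , y) → j , to (G-resp-≈ p i j) x , to (G-resp-≈ q j k) y })
      (λ { (j , x , y) → j , from (G-resp-≈ p i j) x , from (G-resp-≈ q j k) y })
G-resp-≈ (⟪⟫-cong M p) i j =
  mk⇔ (λ { (inj₁ x) → inj₁ (to (G-resp-≈ p i j) x) ; (inj₂ x) → inj₂ x })
      (λ { (inj₁ x) → inj₁ (from (G-resp-≈ p i j) x) ; (inj₂ x) → inj₂ x })
G-resp-≈ (idʳ f) = G-idʳ f
G-resp-≈ (idˡ f) = G-idˡ f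
G-resp-≈ (assoc f g h) = G-assoc f g h
G-resp-≈ (fun-id M A) = G-fun-id M A
G-resp-≈ (fun-∘ M f g) = G-fun-∘ M f g
G-resp-≈ (nat-ε□ f) = G-nat-ε□ f
G-resp-≈ (nat-δ□□ f) = G-nat-δ□□ f
G-resp-≈ (nat-ε◇ f) = G-nat-ε◇ f
G-resp-≈ (nat-δ◇◇ f) = G-nat-δ◇◇ f
G-resp-≈ (com-δ A) = G-com-δ A
G-resp-≈ (com-εδ A) = G-com-εδ A
G-resp-≈ (com-□εδ A) = G-com-□εδ A
G-resp-≈ (mon-δ A) = G-mon-δ A
G-resp-≈ (mon-δε A) = G-mon-δε A
G-resp-≈ (mon-δ◇ε A) = G-mon-δ◇ε A
G-resp-≈ (nat-χ f) = G-nat-χ f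
G-resp-≈ (χ-ε□ A) = G-χ-ε□ A
G-resp-≈ (χ-ε◇ A) = G-χ-ε◇ A
G-resp-≈ (χ-δ□□ A) = G-χ-δ□□ A
G-resp-≈ (χ-δ◇◇ A) = G-χ-δ◇◇ A

len◇^ : ℕ → Modality → ℕ
len◇^ k A = length (◇^ k A)

len◇^-∷ : ∀ k M A → len◇^ k (M ∷ A) ≡ suc (len◇^ k A)
len◇^-∷ zero M A = refl
len◇^-∷ (suc k) M A = cong suc (len◇^-∷ k M A)

length≤len◇^ : ∀ k A → length A ≤ len◇^ k A
length≤len◇^ zero A = ≤-refl
length≤len◇^ (suc k) A = m≤n⇒m≤1+n (length≤len◇^ k A)

G-◇^-cast : ∀ k A → G (◇^-cast k A) ≐ Δ (len◇^ k (◇ ∷ A))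
G-◇^-cast zero A = ≐-refl
G-◇^-cast (suc k) A i j = mk⇔ forth back
  where
  forth : G (◇^-cast (suc k) A) i j → Δ (len◇^ (suc k) (◇ ∷ A)) i j
  forth (inj₁ g) with to (G-◇^-cast k A i j) g
  ... | e , p = e , m<n⇒m<1+n p
  forth (inj₂ (refl , e)) = sym (trans e (sym (len◇^-∷ k ◇ A))) , n<1+n _
  back : Δ (len◇^ (suc k) (◇ ∷ A)) i j → G (◇^-cast (suc k) A) i j
  back (refl , p) with m<1+n⇒m<n∨m≡n p
  ... | inj₁ q = inj₁ (from (G-◇^-cast k A i i) (refl , q))
  ... | inj₂ refl = inj₂ (refl , len◇^-∷ k ◇ A)

χ∘◇-rel : Modality → Modality → Rel₀ → Rel₀
χ∘◇-rel X Y R i j =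
  ((R i j × j < length Y) ⊎ (R i (length Y) × j ≡ suc (length Y))) ⊎ [ length X ↦ length Y ] i j

G-χ∘◇ : ∀ {X Y} (Z : Term X (□ ∷ Y)) → G (χ◇□ Y ∘ ⟪ ◇ ⟫ Z) ≐ χ∘◇-rel X Y (G Z)
G-χ∘◇ {X} {Y} Z i l = mk⇔ forth back
  where
  y : ℕ
  y = length Y
  forth : G (χ◇□ Y ∘ ⟪ ◇ ⟫ Z) i l → χ∘◇-rel X Y (G Z) i l
  forth (j , inj₁ g , inj₁ (refl , p)) = inj₁ (inj₁ (g , p))
  forth (j , inj₁ g , inj₂ (inj₁ (refl , refl))) = inj₁ (inj₂ (g , refl))
  forth (j , inj₁ g , inj₂ (inj₂ (refl , refl))) = ⊥-n<n (G-cod Z g)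
  forth (j , inj₂ (refl , refl) , inj₁ (refl , p)) = ⊥-1+n<n p
  forth (j , inj₂ (refl , refl) , inj₂ (inj₁ (e , _))) = ⊥-1+n≡n e
  forth (j , inj₂ (refl , refl) , inj₂ (inj₂ (refl , refl))) = inj₂ (refl , refl)
  back : χ∘◇-rel X Y (G Z) i l → G (χ◇□ Y ∘ ⟪ ◇ ⟫ Z) i l
  back (inj₁ (inj₁ (g , p))) = l , inj₁ g , inj₁ (refl , p)
  back (inj₁ (inj₂ (g , refl))) = y , inj₁ g , inj₂ (inj₁ (refl , refl))
  back (inj₂ (refl , refl)) = suc y , inj₂ (refl , refl) , inj₂ (inj₂ (refl , refl))

G-χ^ : ∀ k A → G (χ^ k A) ≐ ([ length A ↦ len◇^ k A ] ∪ ShiftBelow (length A) (len◇^ k A))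
G-χ^ zero A i j = mk⇔ forth back
  where
  forth : G (χ^ zero A) i j → ([ length A ↦ length A ] ∪ ShiftBelow (length A) (length A)) i j
  forth (refl , p) with m<1+n⇒m<n∨m≡n p
  ... | inj₁ q = inj₂ (inj₁ (q , refl) , q)
  ... | inj₂ refl = inj₁ (refl , refl)
  back : ([ length A ↦ length A ] ∪ ShiftBelow (length A) (length A)) i j → G (χ^ zero A) i j
  back (inj₁ (refl , refl)) = refl , n<1+n _
  back (inj₂ (inj₁ (q , refl) , _)) = refl , m<n⇒m<1+n q
  back (inj₂ (inj₂ (q , refl) , p)) = ⊥-elim (<⇒≱ p q)
G-χ^ (suc k) A = ≐-trans (G-χ∘◇ (χ^ k A)) step
  where
  a y : ℕ
  a = length A
  y = len◇^ k A
  step : χ∘◇-rel (◇^ k (□ ∷ A)) (◇^ k A) (G (χ^ k A)) ≐ ([ a ↦ suc y ] ∪ ShiftBelow a (suc y))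
  step i j = mk⇔ forth back
    where
    forth : χ∘◇-rel (◇^ k (□ ∷ A)) (◇^ k A) (G (χ^ k A)) i j → ([ a ↦ suc y ] ∪ ShiftBelow a (suc y)) i j
    forth (inj₁ (inj₁ (g , p))) with to (G-χ^ k A i j) g
    ... | inj₁ (_ , refl) = ⊥-n<n p
    ... | inj₂ (sh , _) = inj₂ (sh , m<n⇒m<1+n p)
    forth (inj₁ (inj₂ (g , refl))) with to (G-χ^ k A i y) g
    ... | inj₁ (refl , _) = inj₁ (refl , refl)
    ... | inj₂ (_ , q) = ⊥-n<n q
    forth (inj₂ (refl , refl)) = inj₂ (inj₂ (length≤len◇^ k A , len◇^-∷ k □ A) , n<1+n _)
    back : ([ a ↦ suc y ] ∪ ShiftBelow a (suc y)) i j → χ∘◇-rel (◇^ k (□ ∷ A)) (◇^ k A) (G (χ^ k A)) i j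
    back (inj₁ (refl , refl)) = inj₁ (inj₂ (from (G-χ^ k A i y) (inj₁ (refl , refl)) , refl))
    back (inj₂ (sh , p)) with m<1+n⇒m<n∨m≡n p
    ... | inj₁ q = inj₁ (inj₁ (from (G-χ^ k A i j) (inj₂ (sh , q)) , q))
    ... | inj₂ refl = inj₂ (trans (shift-top (length≤len◇^ k A) sh) (sym (len◇^-∷ k □ A)) , refl)

G-◇^-ε□ : ∀ k A → G (◇^-map k (ε□ A)) ≐ ShiftBelow (length A) (len◇^ k A)
G-◇^-ε□ zero A i j = mk⇔ forth back
  where
  forth : G (ε□ A) i j → ShiftBelow (length A) (length A) i j
  forth (refl , p) = inj₁ (p , refl) , p
  back : ShiftBelow (length A) (length A) i j → G (ε□ A) i j
  back (inj₁ (q , refl) , _) = refl , q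
  back (inj₂ (q , refl) , p) = ⊥-elim (<⇒≱ p q)
G-◇^-ε□ (suc k) A i j = mk⇔ forth back
  where
  forth : G (◇^-map (suc k) (ε□ A)) i j → ShiftBelow (length A) (len◇^ (suc k) A) i j
  forth (inj₁ g) with to (G-◇^-ε□ k A i j) g
  ... | sh , p = sh , m<n⇒m<1+n p
  forth (inj₂ (refl , refl)) = inj₂ (length≤len◇^ k A , len◇^-∷ k □ A) , n<1+n _
  back : ShiftBelow (length A) (len◇^ (suc k) A) i j → G (◇^-map (suc k) (ε□ A)) i j
  back (sh , p) with m<1+n⇒m<n∨m≡n p
  ... | inj₁ q = inj₁ (from (G-◇^-ε□ k A i j) (sh , q))
  ... | inj₂ refl = inj₂ (trans (shift-top (length≤len◇^ k A) sh) (sym (len◇^-∷ k □ A)) , refl)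

G-χ^δ : ∀ k A → G (χ^δ k A) ≐ ([ length A ↦ len◇^ k (□ ∷ A) ] ∪ Δ (len◇^ k (□ ∷ A)))
G-χ^δ zero A i l = mk⇔ forth back
  where
  a : ℕ
  a = length A
  forth : G (χ^δ zero A) i l → ([ a ↦ suc a ] ∪ Δ (suc a)) i l
  forth (j , inj₁ (refl , p) , (refl , _)) = inj₂ (refl , m<n⇒m<1+n p)
  forth (j , inj₂ (inj₁ (refl , refl)) , (refl , _)) = inj₂ (refl , n<1+n _)
  forth (j , inj₂ (inj₂ (refl , refl)) , (refl , _)) = inj₁ (refl , refl)
  back : ([ a ↦ suc a ] ∪ Δ (suc a)) i l → G (χ^δ zero A) i l
  back (inj₁ (refl , refl)) = suc a , inj₂ (inj₂ (refl , refl)) , (refl , n<1+n _)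
  back (inj₂ (refl , p)) with m<1+n⇒m<n∨m≡n p
  ... | inj₁ q = i , inj₁ (refl , q) , (refl , m<n⇒m<1+n p)
  ... | inj₂ refl = a , inj₂ (inj₁ (refl , refl)) , (refl , m<n⇒m<1+n p)
G-χ^δ (suc k) A = ≐-trans (G-resp-≈ (χ^δ-suc k A)) (≐-trans (G-χ∘◇ (χ^δ k A)) step)
  where
  y : ℕ
  y = len◇^ k (□ ∷ A)
  step : χ∘◇-rel (◇^ k (□ ∷ A)) (◇^ k (□ ∷ A)) (G (χ^δ k A)) ≐ ([ length A ↦ suc y ] ∪ Δ (suc y))
  step i j = mk⇔ forth back
    where
    forth : χ∘◇-rel (◇^ k (□ ∷ A)) (◇^ k (□ ∷ A)) (G (χ^δ k A)) i j → ([ length A ↦ suc y ] ∪ Δ (suc y)) i j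
    forth (inj₁ (inj₁ (g , p))) with to (G-χ^δ k A i j) g
    ... | inj₁ (_ , refl) = ⊥-n<n p
    ... | inj₂ (e , q) = inj₂ (e , m<n⇒m<1+n q)
    forth (inj₁ (inj₂ (g , refl))) with to (G-χ^δ k A i y) g
    ... | inj₁ (refl , _) = inj₁ (refl , refl)
    ... | inj₂ (refl , q) = ⊥-n<n q
    forth (inj₂ (refl , refl)) = inj₂ (refl , n<1+n _)
    back : ([ length A ↦ suc y ] ∪ Δ (suc y)) i j → χ∘◇-rel (◇^ k (□ ∷ A)) (◇^ k (□ ∷ A)) (G (χ^δ k A)) i j
    back (inj₁ (refl , refl)) = inj₁ (inj₂ (from (G-χ^δ k A i y) (inj₁ (refl , refl)) , refl))
    back (inj₂ (refl , p)) with m<1+n⇒m<n∨m≡n p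
    ... | inj₁ q = inj₁ (inj₁ (from (G-χ^δ k A i i) (inj₂ (refl , q)) , q))
    ... | inj₂ refl = inj₂ (refl , refl)

rel : ∀ {k A B} → NF k A B → Rel₀
rel nil i j = ⊥
rel (new◇ n) = rel n
rel (keep◇ {k} {A} {B} n) = rel n ∪ [ len◇^ k A ↦ length B ]
rel (merge◇ {k} {A} {B} n) = rel n ∪ [ len◇^ k A ↦ length B ]
rel (pend◇ n) = rel n
rel (drop□ {A = A} n) = Shifted (length A) (rel n)
rel (keep□ {A = A} {B} n) = [ length A ↦ length B ] ∪ Shifted (length A) (rel n)
rel (dup□ {A = A} {B} n) = rel n ∪ [ length A ↦ length B ]

G-ε◇∘ : ∀ {X B} (f : Term X B) → G (ε◇ B ∘ f) ≐ G f
G-ε◇∘ f i l = mk⇔ (λ { (j , g , (refl , _)) → g }) (λ g → l , g , (refl , G-cod f g))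

G-δ◇◇∘◇ : ∀ {X B} (f : Term X (◇ ∷ B)) → G (δ◇◇ B ∘ ⟪ ◇ ⟫ f) ≐ (G f ∪ [ length X ↦ length B ])
G-δ◇◇∘◇ {X} {B} f i l = mk⇔ forth back
  where
  b : ℕ
  b = length B
  forth : G (δ◇◇ B ∘ ⟪ ◇ ⟫ f) i l → (G f ∪ [ length X ↦ b ]) i l
  forth (j , inj₁ g , inj₁ (refl , _)) = inj₁ g
  forth (j , inj₁ g , inj₂ (inj₁ (refl , refl))) = inj₁ g
  forth (j , inj₁ g , inj₂ (inj₂ (refl , refl))) = ⊥-n<n (G-cod f g)
  forth (j , inj₂ (refl , refl) , inj₁ (refl , p)) = ⊥-1+n<n p
  forth (j , inj₂ (refl , refl) , inj₂ (inj₁ (e , refl))) = ⊥-1+n≡n e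
  forth (j , inj₂ (refl , refl) , inj₂ (inj₂ (refl , refl))) = inj₂ (refl , refl)
  back : (G f ∪ [ length X ↦ b ]) i l → G (δ◇◇ B ∘ ⟪ ◇ ⟫ f) i l
  back (inj₁ g) with m<1+n⇒m<n∨m≡n (G-cod f g)
  ... | inj₁ q = l , inj₁ g , inj₁ (refl , q)
  ... | inj₂ refl = b , inj₁ g , inj₂ (inj₁ (refl , refl))
  back (inj₂ (refl , refl)) = suc b , inj₂ (refl , refl) , inj₂ (inj₂ (refl , refl))

G-∘◇^-cast : ∀ k A {C} (f : Term (◇ ∷ ◇^ k A) C) → G (f ∘ ◇^-cast k A) ≐ G f
G-∘◇^-cast k A f i l = mk⇔ forth back
  where
  forth : G (f ∘ ◇^-cast k A) i l → G f i l
  forth (j , c , g) with to (G-◇^-cast k A i j) c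
  ... | refl , _ = g
  back : G f i l → G (f ∘ ◇^-cast k A) i l
  back g = i , from (G-◇^-cast k A i i) (refl , subst (i <_) (sym (len◇^-∷ k ◇ A)) (G-dom f g)) , g

G-∘◇^-ε□ : ∀ k A {C} (f : Term (◇^ k A) C) → G (f ∘ ◇^-map k (ε□ A)) ≐ Shifted (length A) (G f)
G-∘◇^-ε□ k A f i l = mk⇔
  (λ (j , w , g) → j , proj₁ (to (G-◇^-ε□ k A i j) w) , g)
  (λ (j , sh , g) → j , from (G-◇^-ε□ k A i j) (sh , G-dom f g) , g)

G-□∘χ^ : ∀ k A {C} (f : Term (◇^ k A) C) →
         G (⟪ □ ⟫ f ∘ χ^ k A) ≐ ([ length A ↦ length C ] ∪ Shifted (length A) (G f))
G-□∘χ^ k A {C} f i l = mk⇔ forth back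
  where
  forth : G (⟪ □ ⟫ f ∘ χ^ k A) i l → ([ length A ↦ length C ] ∪ Shifted (length A) (G f)) i l
  forth (j , p , inj₁ g) with to (G-χ^ k A i j) p
  ... | inj₁ (_ , refl) = ⊥-n<n (G-dom f g)
  ... | inj₂ (sh , _) = inj₂ (j , sh , g)
  forth (j , p , inj₂ (refl , refl)) with to (G-χ^ k A i j) p
  ... | inj₁ (refl , _) = inj₁ (refl , refl)
  ... | inj₂ (_ , q) = ⊥-n<n q
  back : ([ length A ↦ length C ] ∪ Shifted (length A) (G f)) i l → G (⟪ □ ⟫ f ∘ χ^ k A) i l
  back (inj₁ (refl , refl)) = len◇^ k A , from (G-χ^ k A i (len◇^ k A)) (inj₁ (refl , refl)) , inj₂ (refl , refl)
  back (inj₂ (j , sh , g)) = j , from (G-χ^ k A i j) (inj₂ (sh , G-dom f g)) , inj₁ g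

G-□∘χ^δ : ∀ k A {C} (f : Term (◇^ k (□ ∷ A)) C) →
          G (⟪ □ ⟫ f ∘ χ^δ k A) ≐ (G f ∪ [ length A ↦ length C ])
G-□∘χ^δ k A {C} f i l = mk⇔ forth back
  where
  forth : G (⟪ □ ⟫ f ∘ χ^δ k A) i l → (G f ∪ [ length A ↦ length C ]) i l
  forth (j , p , inj₁ g) with to (G-χ^δ k A i j) p
  ... | inj₁ (_ , refl) = ⊥-n<n (G-dom f g)
  ... | inj₂ (refl , _) = inj₁ g
  forth (j , p , inj₂ (refl , refl)) with to (G-χ^δ k A i j) p
  ... | inj₁ (refl , _) = inj₂ (refl , refl)
  ... | inj₂ (refl , q) = ⊥-n<n q
  back : (G f ∪ [ length A ↦ length C ]) i l → G (⟪ □ ⟫ f ∘ χ^δ k A) i l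
  back (inj₁ g) = i , from (G-χ^δ k A i i) (inj₂ (refl , G-dom f g)) , inj₁ g
  back (inj₂ (refl , refl)) =
    len◇^ k (□ ∷ A) , from (G-χ^δ k A i (len◇^ k (□ ∷ A))) (inj₁ (refl , refl)) , inj₂ (refl , refl)

G-reify : ∀ {k A B} (n : NF k A B) → G (reify n) ≐ rel n
G-reify nil i j = mk⇔ (λ { (refl , ()) }) λ ()
G-reify (new◇ n) = ≐-trans (G-ε◇∘ (reify n)) (G-reify n)
G-reify (keep◇ n) = ∪-cong (G-reify n) ≐-refl
G-reify (merge◇ n) = ≐-trans (G-δ◇◇∘◇ (reify n)) (∪-cong (G-reify n) ≐-refl)
G-reify (pend◇ {k} {A} n) = ≐-trans (G-∘◇^-cast k A (reify n)) (G-reify n)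
G-reify (drop□ {k} {A} n) = ≐-trans (G-∘◇^-ε□ k A (reify n)) (Shifted-cong (G-reify n))
G-reify (keep□ {k} {A} n) = ≐-trans (G-□∘χ^ k A (reify n)) (∪-cong ≐-refl (Shifted-cong (G-reify n)))
G-reify (dup□ {k} {A} n) = ≐-trans (G-□∘χ^δ k A (reify n)) (∪-cong (G-reify n) ≐-refl)

rel-dom : ∀ {k A B} (n : NF k A B) → rel n ⇒ Dom< (len◇^ k A)
rel-dom n r = G-dom (reify n) (from (G-reify n _ _) r)

rel-cod : ∀ {k A B} (n : NF k A B) → rel n ⇒ Cod< (length B)
rel-cod n r = G-cod (reify n) (from (G-reify n _ _) r)

-- A normal form is determined by its relation

cancel-restricted : ∀ {R P Q S T} → R ⇒ Q → (∀ {i j} → P i j → Q i j → ⊥) →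
                    (R ∪ P) ≐ S → T ≐ (S ∩ Q) → R ≐ T
cancel-restricted R⇒Q P#Q h q = ≐-trans (∪-∩-cancel R⇒Q P#Q) (≐-trans (∩-cong h ≐-refl) (≐-sym q))

shift-len◇^ : ∀ k A {i} → Shift (length A) i (len◇^ k (□ ∷ A)) → i ≡ len◇^ k A
shift-len◇^ k A sh = shift-top⁻¹ (length≤len◇^ k A) (subst (Shift (length A) _) (len◇^-∷ k □ A) sh)

restrict-pend◇ : ∀ k A {R S} → R ≐ (S ∩ Dom< (len◇^ (suc k) A)) → R ≐ (S ∩ Dom< (len◇^ k (◇ ∷ A)))
restrict-pend◇ k A q = ≐-trans q (∩-cong ≐-refl (≐-reflexive (cong Dom< (sym (len◇^-∷ k ◇ A)))))

restrict-drop□ : ∀ k A {R S} → R ≐ (S ∩ Dom< (len◇^ k A)) →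
                 Shifted (length A) R ≐ (Shifted (length A) S ∩ Dom< (len◇^ k (□ ∷ A)))
restrict-drop□ k A q = ≐-trans (Shifted-cong q)
  (≐-trans (Shifted-∩-Dom< (length≤len◇^ k A)) (∩-cong ≐-refl (≐-reflexive (cong Dom< (sym (len◇^-∷ k □ A))))))

top-pend◇ : ∀ k A {b R S} → R ≐ S → (R ∪ [ len◇^ (suc k) A ↦ b ]) ≐ (S ∪ [ len◇^ k (◇ ∷ A) ↦ b ])
top-pend◇ k A q = ∪-cong q (≐-reflexive (cong [_↦ _ ] (sym (len◇^-∷ k ◇ A))))

top-drop□ : ∀ k A {b R S} → R ≐ Shifted (length A) S →
            (R ∪ [ len◇^ k (□ ∷ A) ↦ b ]) ≐ Shifted (length A) (S ∪ [ len◇^ k A ↦ b ])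
top-drop□ k A q =
  ≐-trans (∪-cong q (≐-reflexive (cong [_↦ _ ] (len◇^-∷ k □ A)))) (≐-sym (Shifted-∪-↦ (length≤len◇^ k A)))

invert-new◇ : ∀ {k A B} (n' : NF k A (◇ ∷ B)) → (∀ i → ¬ rel n' i (length B)) →
  Σ (NF k A B) λ m → (reify n' ≈ ε◇ B ∘ reify m) × (rel m ≐ rel n')
invert-new◇ (new◇ x) h = x , ≈-refl , ≐-refl
invert-new◇ (keep◇ x) h = ⊥-elim (h _ (inj₂ (refl , refl)))
invert-new◇ (merge◇ x) h = ⊥-elim (h _ (inj₂ (refl , refl)))
invert-new◇ (pend◇ x) h with invert-new◇ x h
... | y , p , q = pend◇ y , ∘-extendʳ _ p , q
invert-new◇ (drop□ {A = A} x) h with invert-new◇ x (λ i' r → h _ (i' , proj₂ (shift-exists (length A) i') , r))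
... | y , p , q = drop□ y , ∘-extendʳ _ p , Shifted-cong q

invert-keep◇ : ∀ {k A B} (n' : NF (suc k) A (◇ ∷ B)) → rel n' (len◇^ k A) (length B) →
  (∀ i → rel n' i (length B) → i ≡ len◇^ k A) →
  Σ (NF k A B) λ m → (reify n' ≈ ⟪ ◇ ⟫ reify m) × (rel m ≐ (rel n' ∩ Dom< (len◇^ k A)))
invert-keep◇ (new◇ x) r₀ u = ⊥-n<n (rel-cod x r₀)
invert-keep◇ (keep◇ x) r₀ u = x , ≈-refl , ∪-∩-cancel (rel-dom x) ↦#Dom<
invert-keep◇ (merge◇ {k} {A} {B} x) r₀ u
  with invert-new◇ x (λ i r → ⊥-n<n (subst (_< len◇^ k A) (u i (inj₁ r)) (rel-dom x r)))
... | y , p , q = y ,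
  ((_ ∘⟨ (⟪⟫-cong ◇ p ⨾ ⟪⟫-∘ ◇)) ⨾ assocˡ ⨾ (mon-δ◇ε B ⟩∘ _) ⨾ idˡ _) ,
  ≐-trans q (∪-∩-cancel (rel-dom x) ↦#Dom<)
invert-keep◇ {k} (pend◇ {A = A} x) r₀ u
  with invert-keep◇ x (subst (λ z → rel x z _) (len◇^-∷ k ◇ A) r₀) (λ i r → trans (u i r) (len◇^-∷ k ◇ A))
... | y , p , q = pend◇ y , ((p ⟩∘ _) ⨾ ≈-sym (⟪⟫-∘ ◇)) , restrict-pend◇ k A q
invert-keep◇ {k} {B = B} (drop□ {A = A} x) (i₀ , sh₀ , r₀) u
  with invert-keep◇ x (subst (λ z → rel x z _) (shift-len◇^ k A sh₀) r₀) u'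
  where
  u' : ∀ i' → rel x i' (length B) → i' ≡ len◇^ k A
  u' i' r = shift-len◇^ k A (subst (Shift (length A) i') (u _ (i' , sh , r)) sh)
    where sh = proj₂ (shift-exists (length A) i')
... | y , p , q = drop□ y , ((p ⟩∘ _) ⨾ ≈-sym (⟪⟫-∘ ◇)) , restrict-drop□ k A q

invert-merge◇ : ∀ {k A B} (n' : NF (suc k) A (◇ ∷ B)) → rel n' (len◇^ k A) (length B) →
  Σ (NF k A (◇ ∷ B)) λ m → (reify n' ≈ δ◇◇ B ∘ ⟪ ◇ ⟫ reify m) × (rel m ≐ (rel n' ∩ Dom< (len◇^ k A)))
invert-merge◇ (new◇ x) r₀ = ⊥-n<n (rel-cod x r₀)
invert-merge◇ {B = B} (keep◇ x) r₀ =
  new◇ x , ≈-sym ((_ ∘⟨ ⟪⟫-∘ ◇) ⨾ assocˡ ⨾ (mon-δ◇ε B ⟩∘ _) ⨾ idˡ _) , ∪-∩-cancel (rel-dom x) ↦#Dom<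
invert-merge◇ (merge◇ x) r₀ = x , ≈-refl , ∪-∩-cancel (rel-dom x) ↦#Dom<
invert-merge◇ {k} (pend◇ {A = A} x) r₀ with invert-merge◇ x (subst (λ z → rel x z _) (len◇^-∷ k ◇ A) r₀)
... | y , p , q = pend◇ y , (∘-extendʳ _ p ⨾ (_ ∘⟨ ≈-sym (⟪⟫-∘ ◇))) , restrict-pend◇ k A q
invert-merge◇ {k} (drop□ {A = A} x) (i₀ , sh₀ , r₀)
  with invert-merge◇ x (subst (λ z → rel x z _) (shift-len◇^ k A sh₀) r₀)
... | y , p , q = drop□ y , (∘-extendʳ _ p ⨾ (_ ∘⟨ ≈-sym (⟪⟫-∘ ◇))) , restrict-drop□ k A q

invert-pend◇ : ∀ {k A B} (n' : NF k (◇ ∷ A) B) →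
  Σ (NF (suc k) A B) λ m → (reify n' ≈ reify m ∘ ◇^-cast k A) × (rel m ≐ rel n')
invert-pend◇ (new◇ x) with invert-pend◇ x
... | y , p , q = new◇ y , ((_ ∘⟨ p) ⨾ assocˡ) , q
invert-pend◇ (keep◇ {k} {A = ◇ ∷ A} x) with invert-pend◇ x
... | y , p , q = keep◇ y , (⟪⟫-cong ◇ p ⨾ ⟪⟫-∘ ◇) , top-pend◇ k A q
invert-pend◇ (merge◇ {k} {A = ◇ ∷ A} x) with invert-pend◇ x
... | y , p , q = merge◇ y , ((_ ∘⟨ (⟪⟫-cong ◇ p ⨾ ⟪⟫-∘ ◇)) ⨾ assocˡ) , top-pend◇ k A q
invert-pend◇ (pend◇ x) = x , ≈-refl , ≐-refl

invert-drop□ : ∀ {k A B} (n' : NF k (□ ∷ A) B) → (∀ j → ¬ rel n' (length A) j) →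
  Σ (NF k A B) λ m → (reify n' ≈ reify m ∘ ◇^-map k (ε□ A)) × (rel n' ≐ Shifted (length A) (rel m))
invert-drop□ (new◇ x) h with invert-drop□ x h
... | y , p , q = new◇ y , ((_ ∘⟨ p) ⨾ assocˡ) , q
invert-drop□ (keep◇ {k} {A = □ ∷ A} x) h with invert-drop□ x (λ j r → h j (inj₁ r))
... | y , p , q = keep◇ y , (⟪⟫-cong ◇ p ⨾ ⟪⟫-∘ ◇) , top-drop□ k A q
invert-drop□ (merge◇ {k} {A = □ ∷ A} x) h with invert-drop□ x (λ j r → h j (inj₁ r))
... | y , p , q = merge◇ y , ((_ ∘⟨ (⟪⟫-cong ◇ p ⨾ ⟪⟫-∘ ◇)) ⨾ assocˡ) , top-drop□ k A q
invert-drop□ (drop□ x) h = x , ≈-refl , ≐-refl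
invert-drop□ (keep□ x) h = ⊥-elim (h _ (inj₁ (refl , refl)))
invert-drop□ (dup□ x) h = ⊥-elim (h _ (inj₂ (refl , refl)))

invert-keep□ : ∀ {k A B} (n' : NF k (□ ∷ A) (□ ∷ B)) → rel n' (length A) (length B) →
  (∀ j → rel n' (length A) j → j ≡ length B) →
  Σ (NF k A B) λ m → (reify n' ≈ ⟪ □ ⟫ reify m ∘ χ^ k A) ×
    (rel n' ≐ ([ length A ↦ length B ] ∪ Shifted (length A) (rel m)))
invert-keep□ (drop□ x) (_ , sh₀ , _) u = ⊥-elim (shift-misses sh₀)
invert-keep□ (keep□ x) r₀ u = x , ≈-refl , ≐-refl
invert-keep□ {k} {A} {B} (dup□ x) r₀ u
  with invert-drop□ x (λ j r → ⊥-n<n (subst (_< length B) (u j (inj₁ r)) (rel-cod x r)))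
... | y , p , q =
  y , (((⟪⟫-cong □ p ⨾ ⟪⟫-∘ □) ⟩∘ _) ⨾ assocʳ ⨾ (_ ∘⟨ □ε□-χ^δ k A)) , ≐-trans ∪-comm (∪-cong ≐-refl q)

invert-dup□ : ∀ {k A B} (n' : NF k (□ ∷ A) (□ ∷ B)) → rel n' (length A) (length B) →
  Σ (NF k (□ ∷ A) B) λ m → (reify n' ≈ ⟪ □ ⟫ reify m ∘ χ^δ k A) × (rel m ≐ (rel n' ∩ Cod< (length B)))
invert-dup□ (drop□ x) (_ , sh₀ , _) = ⊥-elim (shift-misses sh₀)
invert-dup□ {k} {A} (keep□ x) r₀ =
  drop□ x , ≈-sym ((⟪⟫-∘ □ ⟩∘ _) ⨾ assocʳ ⨾ (_ ∘⟨ □ε□-χ^δ k A)) ,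
  ≐-trans (∪-∩-cancel (λ (_ , _ , r) → rel-cod x r) ↦#Cod<) (∩-cong ∪-comm ≐-refl)
invert-dup□ (dup□ x) r₀ = x , ≈-refl , ∪-∩-cancel (rel-cod x) ↦#Cod<

reify-injective : ∀ {k A B} (n n' : NF k A B) → rel n ≐ rel n' → reify n ≈ reify n'
reify-injective nil nil h = ≈-refl
reify-injective (new◇ {B = B} m) n' h with invert-new◇ n' (λ i r → ⊥-n<n (rel-cod m (from (h i (length B)) r)))
... | m' , p , q = (_ ∘⟨ reify-injective m m' (≐-trans h (≐-sym q))) ⨾ ≈-sym p
reify-injective (keep◇ {k} {A} {B} m) n' h with invert-keep◇ n' (to (h _ _) (inj₂ (refl , refl))) top-only
  where
  top-only : ∀ i → rel n' i (length B) → i ≡ len◇^ k A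
  top-only i r with from (h i (length B)) r
  ... | inj₁ x = ⊥-n<n (rel-cod m x)
  ... | inj₂ (e , _) = e
... | m' , p , q = ⟪⟫-cong ◇ (reify-injective m m' (cancel-restricted (rel-dom m) ↦#Dom< h q)) ⨾ ≈-sym p
reify-injective (merge◇ m) n' h with invert-merge◇ n' (to (h _ _) (inj₂ (refl , refl)))
... | m' , p , q = (_ ∘⟨ ⟪⟫-cong ◇ (reify-injective m m' (cancel-restricted (rel-dom m) ↦#Dom< h q))) ⨾ ≈-sym p
reify-injective (pend◇ m) n' h with invert-pend◇ n'
... | m' , p , q = (reify-injective m m' (≐-trans h (≐-sym q)) ⟩∘ _) ⨾ ≈-sym p
reify-injective (drop□ {A = A} m) n' h
  with invert-drop□ n' (λ j r → shift-misses (proj₁ (proj₂ (from (h (length A) j) r))))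
... | m' , p , q = (reify-injective m m' (Shifted-injective (≐-trans h q)) ⟩∘ _) ⨾ ≈-sym p
reify-injective (keep□ {A = A} {B} m) n' h with invert-keep□ n' (to (h _ _) (inj₁ (refl , refl))) top-only
  where
  top-only : ∀ j → rel n' (length A) j → j ≡ length B
  top-only j r with from (h (length A) j) r
  ... | inj₁ (_ , e) = e
  ... | inj₂ (_ , sh , _) = ⊥-elim (shift-misses sh)
... | m' , p , q =
  (⟪⟫-cong □ (reify-injective m m' (Shifted-injective (∪-cancelˡ (↦#Shifted {R = rel m}) (↦#Shifted {R = rel m'}) (≐-trans h q)))) ⟩∘ _) ⨾ ≈-sym p
reify-injective (dup□ m) n' h with invert-dup□ n' (to (h _ _) (inj₂ (refl , refl)))
... | m' , p , q = (⟪⟫-cong □ (reify-injective m m' (cancel-restricted (rel-cod m) ↦#Cod< h q)) ⟩∘ _) ⨾ ≈-sym p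

mainTheorem3 : {A B : Modality} (f g : Term A B) → G f ≐ G g → f ≈ g
mainTheorem3 f g h = nf-sound f ⨾ reify-injective (nf f) (nf g) same-rel ⨾ ≈-sym (nf-sound g)
  where
  same-rel : rel (nf f) ≐ rel (nf g)
  same-rel = ≐-trans (≐-sym (G-reify (nf f)))
    (≐-trans (≐-sym (G-resp-≈ (nf-sound f)))
    (≐-trans h
    (≐-trans (G-resp-≈ (nf-sound g)) (G-reify (nf g)))))
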